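{- Let $G$ be a finite simple graph with at least one vertex whose complement $G^c$ is chordal and clique vertex irreducible. Then $\operatorname{bp}(G)=\operatorname{mc}(G^c)-1$.
   Context: A graph is chordal if it has no induced cycle of length greater than $3$. A graph is clique vertex irreducible if every maximal clique of it contains a vertex that lies in no other maximal clique. $\operatorname{mc}(H)$ is the number of maximal cliques of $H$. A biclique $\{L,R\}$ is the complete bipartite graph with disjoint vertex sets $L,R$ and edge set $\{uv:u\in L,v\in R\}$; a biclique partition of $G$ is a collection of biclique subgraphs of $G$ such that every edge lies in exactly one of them; $\operatorname{bp}(G)$ is the minimum size of a biclique partition. -}

module Defs where

open import Data.Nat using (ℕ; zero; suc; _≤_; _+_)
open import Data.Fin using (Fin; toℕ; _≟_)
open import Data.Fin.Subset using (Subset; _∈_; _∉_; _⊆_)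
open import Data.Vec using (lookup)
open import Data.Bool using (Bool; true; false; not; _∧_; _∨_; if_then_else_)
open import Data.Bool.Properties using (∧-zeroʳ)
open import Data.List using (List; []; _∷_; length)
import Data.List.Membership.Propositional as LM
open import Data.List.Relation.Unary.All using (All)
open import Data.List.Relation.Unary.Unique.Propositional using (Unique)
open import Data.Product using (Σ; ∃; _×_; _,_)
open import Data.Sum using (_⊎_)
open import Relation.Nullary using (¬_; yes; no)
open import Relation.Nullary.Decidable using (⌊_⌋)
open import Relation.Binary.PropositionalEquality using (_≡_; _≢_; refl; sym; cong; cong₂)
open import Function.Bundles using (_⇔_)

record Graph (n : ℕ) : Set where
  field
    Adj    : Fin n → Fin n → Bool
    symm   : ∀ u v → Adj u v ≡ Adj v u
    irrefl : ∀ v → Adj v v ≡ false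
open Graph public

Edge : ∀ {n} → Graph n → Fin n → Fin n → Set
Edge G u v = Adj G u v ≡ true

private
  eqb : ∀ {n} (u v : Fin n) → Bool
  eqb u v = ⌊ u ≟ v ⌋

  eqb-sym : ∀ {n} (u v : Fin n) → eqb u v ≡ eqb v u
  eqb-sym u v with u ≟ v | v ≟ u
  ... | yes _ | yes _ = refl
  ... | no _  | no _  = refl
  ... | yes p | no q  = Data.Empty.⊥-elim (q (sym p)) where import Data.Empty
  ... | no p  | yes q = Data.Empty.⊥-elim (p (sym q)) where import Data.Empty

  eqb-refl : ∀ {n} (v : Fin n) → eqb v v ≡ true
  eqb-refl v with v ≟ v
  ... | yes _ = refl
  ... | no p  = Data.Empty.⊥-elim (p refl) where import Data.Empty

complement : ∀ {n} → Graph n → Graph n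
complement G = record
  { Adj    = λ u v → not (Adj G u v) ∧ not (eqb u v)
  ; symm   = λ u v → cong₂ (λ a b → not a ∧ not b) (symm G u v) (eqb-sym u v)
  ; irrefl = λ v → trans' (cong (λ b → not (Adj G v v) ∧ not b) (eqb-refl v)) (∧-zeroʳ _)
  }
  where
  open import Relation.Binary.PropositionalEquality using () renaming (trans to trans')

IsClique : ∀ {n} → Graph n → Subset n → Set
IsClique G S = ∀ u v → u ∈ S → v ∈ S → u ≢ v → Edge G u v

IsMaximalClique : ∀ {n} → Graph n → Subset n → Set
IsMaximalClique G S = IsClique G S × (∀ T → IsClique G T → S ⊆ T → T ⊆ S)

HasMC : ∀ {n} → Graph n → ℕ → Set
HasMC {n} H m = Σ (List (Subset n)) λ L →
  Unique L × (∀ S → (S LM.∈ L) ⇔ IsMaximalClique H S) × length L ≡ m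

CliqueVertexIrreducible : ∀ {n} → Graph n → Set
CliqueVertexIrreducible H = ∀ S → IsMaximalClique H S →
  ∃ λ v → v ∈ S × (∀ T → IsMaximalClique H T → v ∈ T → T ≡ S)

CycSucc : (k : ℕ) → Fin k → Fin k → Set
CycSucc k i j = (suc (toℕ i) ≡ toℕ j) ⊎ ((suc (toℕ i) ≡ k) × (toℕ j ≡ 0))

CycAdj : (k : ℕ) → Fin k → Fin k → Set
CycAdj k i j = CycSucc k i j ⊎ CycSucc k j i

InducedCycle : ∀ {n} → Graph n → ℕ → Set
InducedCycle {n} H k = Σ (Fin k → Fin n) λ c →
  (∀ i j → c i ≡ c j → i ≡ j) × (∀ i j → Edge H (c i) (c j) ⇔ CycAdj k i j)

Chordal : ∀ {n} → Graph n → Set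
Chordal H = ∀ k → 4 ≤ k → ¬ InducedCycle H k

record Biclique (n : ℕ) : Set where
  constructor ⟨_,_⟩
  field
    L R : Subset n
open Biclique public

IsBicliqueOf : ∀ {n} → Graph n → Biclique n → Set
IsBicliqueOf G B = (∀ v → v ∈ L B → v ∉ R B) × (∀ u v → u ∈ L B → v ∈ R B → Edge G u v)

covers : ∀ {n} → Biclique n → Fin n → Fin n → Bool
covers B u v = (lookup (L B) u ∧ lookup (R B) v) ∨ (lookup (L B) v ∧ lookup (R B) u)

coverCount : ∀ {n} → List (Biclique n) → Fin n → Fin n → ℕ
coverCount [] u v = 0
coverCount (B ∷ Bs) u v = (if covers B u v then 1 else 0) + coverCount Bs u v

IsBicliquePartition : ∀ {n} → Graph n → List (Biclique n) → Set
IsBicliquePartition G Bs = All (IsBicliqueOf G) Bs × (∀ u v → Edge G u v → coverCount Bs u v ≡ 1)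

HasBP : ∀ {n} → Graph n → ℕ → Set
HasBP G m = (∃ λ Bs → IsBicliquePartition G Bs × length Bs ≡ m)
          × (∀ Bs → IsBicliquePartition G Bs → m ≤ length Bs)

-- Write H for the complement of G.
--
-- A chordal graph that is not complete has a leaf clique C: the set P of vertices of C
-- without neighbours outside C is nonempty, and C − P lies in another maximal clique K. Removing P
-- therefore removes exactly the maximal clique C, while the G-edges at P form the single biclique
-- between P and the remaining vertices outside C. By induction G has a biclique partition with
-- mc(H) − 1 members. Leaf cliques are found from simplicial vertices, which exist by Dirac's argument:
-- for a non-edge ux, the neighbours of u next to the component A of x in H − N[u] form a clique, since
-- a path through A between two non-adjacent ones would close a chordless cycle through u.
--
-- Clique vertex irreducibility picks in each maximal clique of H a vertex lying in no
-- other one; these vertices are pairwise non-adjacent in H, so they form a clique of size mc(H) in G.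
-- For a biclique partition of G with fewer than mc(H) − 1 members there is a nonzero integer vector z
-- on this clique orthogonal to the all-ones vector and to the left side of every biclique. Then
-- 0 = (∑ zᵢ)² = ∑ zᵢ² + ∑ over bicliques of 2 (∑_L z)(∑_R z) = ∑ zᵢ², a contradiction (Graham–Pollak).

module Submission where

open import Defs
open import Data.Nat.Base using (ℕ; zero; suc; _≤_; _<_; _≮_; _∸_; s≤s; z≤n)
import Data.Nat.Base as ℕ
import Data.Nat.Properties as ℕ
open import Data.Bool.Base using (Bool; true; false; _∧_; if_then_else_)
import Data.Bool.Properties as Bool
open import Data.Fin.Base using (Fin; zero; suc; toℕ; fromℕ)
import Data.Fin.Properties as Fin
open import Data.Fin.Subset using (Subset; _∈_; _∉_; _⊆_; _⊂_; _⊃_; _∪_; _∩_; _─_; ⁅_⁆; ⊤; Nonempty)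
open import Data.Fin.Subset.Properties
  using ( _∈?_; ∈⊤; ⊆⊤; ⊆-antisym; x∈⁅x⁆; x∈⁅y⁆⇒x≡y; x∉⁅y⁆⇒x≢y; x∈p∪q⁺; x∈p∪q⁻; p⊆p∪q; x∈p∩q⁺; x∈p∩q⁻
        ; p∩q⊆p; drop-there; x∈p∧x∉q⇒x∈p─q; x∈p∧x≢y⇒x∈p-y; x∈p⇒p-x⊂p; p∩q≢∅⇒p─q⊂p; nonempty?)
open import Data.Fin.Subset.Induction using (⊂-wellFounded; ⊃-wellFounded)
import Data.Vec.Base as Vec
open import Data.Vec.Base using ([]; _∷_; here; there; tabulate)
open import Data.Vec.Properties using (lookup∘tabulate; lookup⇒[]=; []=⇒lookup; ≡-dec)
open import Data.List.Base using (List; []; _∷_; length; _++_; lookup)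
open import Data.List.Membership.Propositional using () renaming (_∈_ to _∈ˡ_)
open import Data.List.Membership.Propositional.Properties using (∈-lookup)
open import Data.List.Relation.Unary.All as All using (All; []; _∷_)
open import Data.List.Relation.Unary.All.Properties using (++⁺; ¬Any⇒All¬)
open import Data.List.Relation.Unary.Any using (Any; here; there; any?)
open import Data.List.Relation.Unary.AllPairs using ([]; _∷_)
open import Data.List.Relation.Unary.Unique.Propositional using (Unique)
open import Data.Product.Base as Product using (∃; _×_; _,_; proj₁; proj₂)
open import Data.Sum.Base as Sum using (_⊎_; inj₁; inj₂; [_,_]′)
open import Data.Empty using (⊥; ⊥-elim)
import Data.Unit.Base as Unit
open import Data.Unit.Base using (tt)
open import Function.Base using (_∘_; id)
open import Function.Bundles using (_⇔_; mk⇔; Equivalence)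
open import Function.Construct.Composition using (_⇔-∘_)
open import Induction.WellFounded using (Acc; acc)
open import Relation.Nullary using (¬_; Dec; yes; no; does; contradiction; ¬?)
open import Relation.Nullary.Decidable using (dec-true; _×-dec_; _→-dec_; _⊎-dec_; decidable-stable)
open import Relation.Unary using (Pred; Decidable)
open import Relation.Binary.PropositionalEquality

open Equivalence using (to; from)

private
  variable
    n : ℕ

x∈p∪⁅y⁆⁻ : ∀ {x} (p : Subset n) y → x ∈ p ∪ ⁅ y ⁆ → x ∈ p ⊎ x ≡ y
x∈p∪⁅y⁆⁻ p y = Sum.map₂ (x∈⁅y⁆⇒x≡y y) ∘ x∈p∪q⁻ p ⁅ y ⁆

x∈p─q⁻ : ∀ {x} (p q : Subset n) → x ∈ p ─ q → x ∈ p × x ∉ q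
x∈p─q⁻ (true ∷ p) (false ∷ q) here       = here , λ ()
x∈p─q⁻ {x = zero} (false ∷ p) (true  ∷ q) ()
x∈p─q⁻ {x = zero} (false ∷ p) (false ∷ q) ()
x∈p─q⁻ (_    ∷ p) (_     ∷ q) (there x∈) with x∈p , x∉q ← x∈p─q⁻ p q x∈ = there x∈p , x∉q ∘ drop-there

x∈p-y⁻ : ∀ {x} (p : Subset n) y → x ∈ p ─ ⁅ y ⁆ → x ∈ p × x ≢ y
x∈p-y⁻ p y x∈ = Product.map₂ x∉⁅y⁆⇒x≢y (x∈p─q⁻ p ⁅ y ⁆ x∈)

p⊂p∪⁅x⁆ : ∀ {x} {p : Subset n} → x ∉ p → p ⊂ p ∪ ⁅ x ⁆
p⊂p∪⁅x⁆ {x = x} x∉p = p⊆p∪q ⁅ x ⁆ , x , x∈p∪q⁺ (inj₂ (x∈⁅x⁆ x)) , x∉p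

p∪⁅x⁆⊆q : ∀ {x} {p q : Subset n} → p ⊆ q → x ∈ q → p ∪ ⁅ x ⁆ ⊆ q
p∪⁅x⁆⊆q {x = x} {p} p⊆q x∈q y∈ with x∈p∪⁅y⁆⁻ p x y∈
... | inj₁ y∈p = p⊆q y∈p
... | inj₂ refl = x∈q

setOf : ∀ {ℓ} {P : Pred (Fin n) ℓ} → Decidable P → Subset n
setOf P? = tabulate (does ∘ P?)

module _ {ℓ} {P : Pred (Fin n) ℓ} (P? : Decidable P) where

  ∈-setOf⁺ : ∀ {x} → P x → x ∈ setOf P?
  ∈-setOf⁺ {x = x} px = lookup⇒[]= x (setOf P?) (trans (lookup∘tabulate (does ∘ P?) x) (dec-true (P? x) px))

  ∈-setOf⁻ : ∀ {x} → x ∈ setOf P? → P x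
  ∈-setOf⁻ {x = x} x∈ with P? x | trans (sym (lookup∘tabulate (does ∘ P?) x)) ([]=⇒lookup x∈)
  ... | yes px | _ = px

Disjoint : Biclique n → Set
Disjoint B = ∀ v → v ∈ L B → v ∉ R B

covers-diagonal : ∀ (B : Biclique n) → Disjoint B → ∀ u → covers B u u ≡ false
covers-diagonal B disjoint u with Vec.lookup (L B) u in Lu | Vec.lookup (R B) u in Ru
... | true  | true  = contradiction (lookup⇒[]= u (R B) Ru) (disjoint u (lookup⇒[]= u (L B) Lu))
... | true  | false = refl
... | false | _     = refl

coverCount-diagonal : ∀ (Bs : List (Biclique n)) → All Disjoint Bs → ∀ u → coverCount Bs u u ≡ 0
coverCount-diagonal []       []                   u = refl
coverCount-diagonal (B ∷ Bs) (disjoint ∷ disjoints) u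
  rewrite covers-diagonal B disjoint u = coverCount-diagonal Bs disjoints u

∉⇒lookup≡false : ∀ {x} {p : Subset n} → x ∉ p → Vec.lookup p x ≡ false
∉⇒lookup≡false {x = x} {p} x∉p = Bool.¬-not (x∉p ∘ lookup⇒[]= x p)

covers-sym : ∀ (B : Biclique n) u v → covers B u v ≡ covers B v u
covers-sym B u v = Bool.∨-comm (Vec.lookup (L B) u ∧ Vec.lookup (R B) v) (Vec.lookup (L B) v ∧ Vec.lookup (R B) u)

coverCount-sym : ∀ (Bs : List (Biclique n)) u v → coverCount Bs u v ≡ coverCount Bs v u
coverCount-sym []       u v = refl
coverCount-sym (B ∷ Bs) u v = cong₂ (λ b c → (if b then 1 else 0) ℕ.+ c) (covers-sym B u v) (coverCount-sym Bs u v)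

covers-∈ : ∀ {B : Biclique n} {u v} → u ∈ L B → v ∈ R B → covers B u v ≡ true
covers-∈ u∈L v∈R rewrite []=⇒lookup u∈L | []=⇒lookup v∈R = refl

covers-∉L : ∀ {B : Biclique n} {u v} → u ∉ L B → v ∉ L B → covers B u v ≡ false
covers-∉L u∉L v∉L rewrite ∉⇒lookup≡false u∉L | ∉⇒lookup≡false v∉L = refl

covers-∉ : ∀ {B : Biclique n} {u v} → u ∉ L B → u ∉ R B → covers B u v ≡ false
covers-∉ {B = B} {v = v} u∉L u∉R rewrite ∉⇒lookup≡false u∉L | ∉⇒lookup≡false u∉R = Bool.∧-zeroʳ (Vec.lookup (L B) v)

coverCount-outside : ∀ {W : Subset n} Bs → All (λ B → L B ⊆ W × R B ⊆ W) Bs →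
                     ∀ {u} v → u ∉ W → coverCount Bs u v ≡ 0
coverCount-outside []       []                    v u∉W = refl
coverCount-outside (B ∷ Bs) ((L⊆W , R⊆W) ∷ inside) v u∉W
  rewrite covers-∉ {B = B} {v = v} (u∉W ∘ L⊆W) (u∉W ∘ R⊆W) = coverCount-outside Bs inside v u∉W

module GrahamPollak where

  open import Data.Integer.Base using (ℤ; 0ℤ; 1ℤ; +_; -_; _+_; _*_; _-_)
  import Data.Integer as ℤ
  open import Data.Integer.Properties
    using ( +-*-semiring; i*j≡0⇒i≡0∨j≡0; *-zeroˡ; *-zeroʳ; +-identityˡ; +-identityʳ; *-identityˡ; +◃n≡+n
          ; ≤-antisym; +-monoʳ-≤; +-mono-≤; *-distribʳ-+)
  open import Data.Integer.Tactic.RingSolver using (solve-∀)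
  open import Algebra.Properties.Semiring.Sum +-*-semiring
    using (sum-syntax; sum-cong-≗; ∑-distrib-+; *-distribˡ-sum; *-distribʳ-sum; sum-replicate-zero)
  open import Data.List.Base using (map)
  open import Data.List.Properties using (length-map; length-removeAt′)
  open import Data.List.Relation.Unary.All.Properties using (¬All⇒Any¬; ─⁻; map⁻)
  import Data.List.Relation.Unary.Any as Any
  open import Data.List.Relation.Unary.Any.Properties using (lookup-result)
  open ≡-Reasoning

  infix 7 _·_

  _·_ : ∀ {m} → (Fin m → ℤ) → (Fin m → ℤ) → ℤ
  _·_ {m} f z = ∑[ i < m ] (f i * z i)

  -- One step of Gaussian elimination: the first unknown is eliminated with the equation g (where
  -- g zero ≢ 0ℤ), and ·-lift turns solutions of the reduced equations into solutions of the original ones.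
  module Elimination {m} (g : Fin (suc m) → ℤ) where

    reduce : (Fin (suc m) → ℤ) → (Fin m → ℤ)
    reduce h i = g zero * h (suc i) - h zero * g (suc i)

    lift : (Fin m → ℤ) → (Fin (suc m) → ℤ)
    lift y zero    = - ((g ∘ suc) · y)
    lift y (suc i) = g zero * y i

    ·-lift : ∀ h y → h · lift y ≡ reduce h · y
    ·-lift h y = begin
      h zero * - (g′ · y) + ∑[ i < m ] (h (suc i) * (g zero * y i))
        ≡⟨ cong (_+_ (h zero * - (g′ · y))) (trans (sum-cong-≗ (λ i → swap (h (suc i)) (g zero) (y i)))
                                                 (sym (*-distribˡ-sum (g zero) (λ i → h (suc i) * y i)))) ⟩
      h zero * - (g′ · y) + g zero * (h′ · y)
        ≡⟨ regroup (h zero) (g′ · y) (g zero) (h′ · y) ⟩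
      g zero * (h′ · y) + (- h zero) * (g′ · y)
        ≡⟨ cong₂ _+_ (*-distribˡ-sum (g zero) (λ i → h′ i * y i)) (*-distribˡ-sum (- h zero) (λ i → g′ i * y i)) ⟩
      ∑[ i < m ] (g zero * (h′ i * y i)) + ∑[ i < m ] (- h zero * (g′ i * y i))
        ≡⟨ sym (∑-distrib-+ (λ i → g zero * (h′ i * y i)) (λ i → - h zero * (g′ i * y i))) ⟩
      ∑[ i < m ] (g zero * (h′ i * y i) + - h zero * (g′ i * y i))
        ≡⟨ sum-cong-≗ (λ i → expand (g zero) (h′ i) (h zero) (g′ i) (y i)) ⟩
      reduce h · y ∎
      where
      g′ h′ : Fin m → ℤ
      g′ = g ∘ suc
      h′ = h ∘ suc
      swap : ∀ a b c → a * (b * c) ≡ b * (a * c)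
      swap = solve-∀
      regroup : ∀ a b c d → a * - b + c * d ≡ c * d + (- a) * b
      regroup = solve-∀
      expand : ∀ a b c d e → a * (b * e) + - c * (d * e) ≡ (a * b - c * d) * e
      expand = solve-∀

    ·-lift-self : ∀ y → g · lift y ≡ 0ℤ
    ·-lift-self y = begin
      g · lift y                   ≡⟨ ·-lift g y ⟩
      ∑[ i < m ] (reduce g i * y i) ≡⟨ sum-cong-≗ (λ i → cong (_* y i) (cancel (g zero) (g (suc i)))) ⟩
      ∑[ i < m ] (0ℤ * y i)         ≡⟨ sum-cong-≗ (λ i → *-zeroˡ (y i)) ⟩
      ∑[ i < m ] 0ℤ                 ≡⟨ sum-replicate-zero m ⟩
      0ℤ                           ∎
      where
      cancel : ∀ a b → a * b - a * b ≡ 0ℤ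
      cancel = solve-∀

  nontrivial-solution : ∀ m (fs : List (Fin m → ℤ)) → length fs < m →
                        ∃ λ z → (∃ λ i → z i ≢ 0ℤ) × All (λ f → f · z ≡ 0ℤ) fs
  nontrivial-solution (suc m) fs len with All.all? (λ f → f zero ℤ.≟ 0ℤ) fs
  ... | yes heads≡0 = e₀ , (zero , λ ()) , All.map (λ {f} f₀≡0 → ·-e₀ f f₀≡0) heads≡0
    where
    e₀ : Fin (suc m) → ℤ
    e₀ zero    = 1ℤ
    e₀ (suc _) = 0ℤ
    ·-e₀ : ∀ f → f zero ≡ 0ℤ → f · e₀ ≡ 0ℤ
    ·-e₀ f f₀≡0 = begin
      f zero * 1ℤ + ∑[ i < m ] (f (suc i) * 0ℤ) ≡⟨ cong₂ _+_ (cong (_* 1ℤ) f₀≡0) (sum-cong-≗ (λ i → *-zeroʳ (f (suc i)))) ⟩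
      0ℤ + ∑[ i < m ] 0ℤ                        ≡⟨ sum-replicate-zero (suc m) ⟩
      0ℤ                                        ∎
  ... | no ¬heads≡0 with nonzero ← ¬All⇒Any¬ (λ f → f zero ℤ.≟ 0ℤ) fs ¬heads≡0 = z , z≢0 , ─⁻ nonzero g·z≡0 rest·z≡0
    where
    g : Fin (suc m) → ℤ
    g = Any.lookup nonzero

    rest : List (Fin (suc m) → ℤ)
    rest = fs Any.─ nonzero

    open Elimination g

    recursive : ∃ λ y → (∃ λ i → y i ≢ 0ℤ) × All (λ f → f · y ≡ 0ℤ) (map reduce rest)
    recursive = nontrivial-solution m (map reduce rest)
      (subst (_< m) (sym (length-map reduce rest)) (ℕ.≤-pred (subst (_< suc m) (length-removeAt′ fs _) len)))

    y : Fin m → ℤ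
    y = proj₁ recursive

    z : Fin (suc m) → ℤ
    z = lift y

    z≢0 : ∃ λ i → z i ≢ 0ℤ
    z≢0 with i , yᵢ≢0 ← proj₁ (proj₂ recursive) =
      suc i , [ lookup-result nonzero , yᵢ≢0 ]′ ∘ i*j≡0⇒i≡0∨j≡0 (g zero)
    g·z≡0 : g · z ≡ 0ℤ
    g·z≡0 = ·-lift-self y
    rest·z≡0 : All (λ h → h · z ≡ 0ℤ) rest
    rest·z≡0 = All.map (λ {h} reduce-h·y≡0 → trans (·-lift h y) reduce-h·y≡0) (map⁻ (proj₂ (proj₂ recursive)))

  𝟙 : Bool → ℤ
  𝟙 true  = 1ℤ
  𝟙 false = 0ℤ

  δ : ∀ {m} → Fin m → Fin m → ℤ
  δ zero    zero    = 1ℤ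
  δ zero    (suc _) = 0ℤ
  δ (suc _) zero    = 0ℤ
  δ (suc i) (suc j) = δ i j

  δ-diagonal : ∀ {m} (i : Fin m) → δ i i ≡ 1ℤ
  δ-diagonal zero    = refl
  δ-diagonal (suc i) = δ-diagonal i

  δ-off-diagonal : ∀ {m} {i j : Fin m} → i ≢ j → δ i j ≡ 0ℤ
  δ-off-diagonal {i = zero}  {zero}  i≢j = contradiction refl i≢j
  δ-off-diagonal {i = zero}  {suc j} i≢j = refl
  δ-off-diagonal {i = suc i} {zero}  i≢j = refl
  δ-off-diagonal {i = suc i} {suc j} i≢j = δ-off-diagonal (i≢j ∘ cong suc)

  ∑-δ : ∀ {m} (i : Fin m) (w : Fin m → ℤ) → ∑[ j < m ] (δ i j * w j) ≡ w i
  ∑-δ {suc m} zero w = begin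
    1ℤ * w zero + ∑[ j < m ] (0ℤ * w (suc j)) ≡⟨ cong₂ _+_ (*-identityˡ (w zero)) (sum-cong-≗ (λ j → *-zeroˡ (w (suc j)))) ⟩
    w zero + ∑[ j < m ] 0ℤ                    ≡⟨ cong (_+_ (w zero)) (sum-replicate-zero m) ⟩
    w zero + 0ℤ                               ≡⟨ +-identityʳ (w zero) ⟩
    w zero                                    ∎
  ∑-δ {suc m} (suc i) w = begin
    0ℤ * w zero + ∑[ j < m ] (δ i j * w (suc j)) ≡⟨ cong (_+ ∑[ j < m ] (δ i j * w (suc j))) (*-zeroˡ (w zero)) ⟩
    0ℤ + ∑[ j < m ] (δ i j * w (suc j))          ≡⟨ +-identityˡ (∑[ j < m ] (δ i j * w (suc j))) ⟩
    ∑[ j < m ] (δ i j * w (suc j))               ≡⟨ ∑-δ i (w ∘ suc) ⟩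
    w (suc i)                                    ∎

  square-nonneg : ∀ i → 0ℤ ℤ.≤ i * i
  square-nonneg (+ n)      = subst (0ℤ ℤ.≤_) (sym (+◃n≡+n (n ℕ.* n))) (ℤ.+≤+ ℕ.z≤n)
  square-nonneg ℤ.-[1+ n ] = subst (0ℤ ℤ.≤_) (sym (+◃n≡+n (suc n ℕ.* suc n))) (ℤ.+≤+ ℕ.z≤n)

  nonneg-+≡0 : ∀ {a b} → 0ℤ ℤ.≤ a → 0ℤ ℤ.≤ b → a + b ≡ 0ℤ → a ≡ 0ℤ × b ≡ 0ℤ
  nonneg-+≡0 {a} {b} 0≤a 0≤b a+b≡0 = a≡0 , trans (sym (+-identityˡ b)) (trans (cong (_+ b) (sym a≡0)) a+b≡0)
    where
    a≤0 : a ℤ.≤ 0ℤ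
    a≤0 = subst₂ ℤ._≤_ (+-identityʳ a) a+b≡0 (+-monoʳ-≤ a 0≤b)
    a≡0 = ≤-antisym a≤0 0≤a

  ∑-nonneg : ∀ {m} (f : Fin m → ℤ) → (∀ i → 0ℤ ℤ.≤ f i) → 0ℤ ℤ.≤ ∑[ i < m ] f i
  ∑-nonneg {zero}  f 0≤f = ℤ.+≤+ ℕ.z≤n
  ∑-nonneg {suc m} f 0≤f = +-mono-≤ (0≤f zero) (∑-nonneg (f ∘ suc) (0≤f ∘ suc))

  ∑-nonneg≡0 : ∀ {m} (f : Fin m → ℤ) → (∀ i → 0ℤ ℤ.≤ f i) → ∑[ i < m ] f i ≡ 0ℤ → ∀ i → f i ≡ 0ℤ
  ∑-nonneg≡0 {suc m} f 0≤f ∑f≡0 i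
    with f₀≡0 , ∑rest≡0 ← nonneg-+≡0 (0≤f zero) (∑-nonneg (f ∘ suc) (0≤f ∘ suc)) ∑f≡0
    with i
  ... | zero  = f₀≡0
  ... | suc i = ∑-nonneg≡0 (f ∘ suc) (0≤f ∘ suc) ∑rest≡0 i

  ∑-squares≡0 : ∀ {m} (z : Fin m → ℤ) → ∑[ i < m ] (z i * z i) ≡ 0ℤ → ∀ i → z i ≡ 0ℤ
  ∑-squares≡0 z ∑z²≡0 i =
    [ id , id ]′ (i*j≡0⇒i≡0∨j≡0 (z i) (∑-nonneg≡0 (λ i → z i * z i) (λ i → square-nonneg (z i)) ∑z²≡0 i))

  module QuadraticForm {m} (z : Fin m → ℤ) where

    Q : (Fin m → Fin m → ℤ) → ℤ
    Q a = ∑[ i < m ] ∑[ j < m ] (a i j * (z i * z j))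

    Q-cong : ∀ {a b} → (∀ i j → a i j ≡ b i j) → Q a ≡ Q b
    Q-cong a≗b = sum-cong-≗ (λ i → sum-cong-≗ (λ j → cong (_* (z i * z j)) (a≗b i j)))

    Q-+ : ∀ a b → Q (λ i j → a i j + b i j) ≡ Q a + Q b
    Q-+ a b = trans
      (sum-cong-≗ (λ i → trans (sum-cong-≗ (λ j → *-distribʳ-+ (z i * z j) (a i j) (b i j)))
                               (∑-distrib-+ (λ j → a i j * (z i * z j)) (λ j → b i j * (z i * z j)))))
      (∑-distrib-+ (λ i → ∑[ j < m ] (a i j * (z i * z j))) (λ i → ∑[ j < m ] (b i j * (z i * z j))))

    Q-0 : Q (λ _ _ → 0ℤ) ≡ 0ℤ
    Q-0 = trans (sum-cong-≗ (λ i → trans (sum-cong-≗ (λ j → *-zeroˡ (z i * z j))) (sum-replicate-zero m)))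
                (sum-replicate-zero m)

    Q-δ : Q δ ≡ ∑[ i < m ] (z i * z i)
    Q-δ = sum-cong-≗ (λ i → ∑-δ i (λ j → z i * z j))

    Q-outer : ∀ ℓ r → Q (λ i j → ℓ i * r j) ≡ (ℓ · z) * (r · z)
    Q-outer ℓ r = begin
      ∑[ i < m ] ∑[ j < m ] (ℓ i * r j * (z i * z j))   ≡⟨ Q-cong′ ⟩
      ∑[ i < m ] ∑[ j < m ] (ℓ i * z i * (r j * z j))   ≡⟨ sum-cong-≗ (λ i → sym (*-distribˡ-sum (ℓ i * z i) (λ j → r j * z j))) ⟩
      ∑[ i < m ] (ℓ i * z i * (r · z))                 ≡⟨ sym (*-distribʳ-sum (r · z) (λ i → ℓ i * z i)) ⟩
      (ℓ · z) * (r · z)                                ∎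
      where
      rearrange : ∀ a b c d → a * b * (c * d) ≡ a * c * (b * d)
      rearrange = solve-∀
      Q-cong′ = sum-cong-≗ (λ i → sum-cong-≗ (λ j → rearrange (ℓ i) (r j) (z i) (z j)))

  covers-𝟙 : ∀ {n} (B : Biclique n) → Disjoint B → ∀ u v →
             𝟙 (covers B u v) ≡ 𝟙 (Vec.lookup (L B) u) * 𝟙 (Vec.lookup (R B) v) + 𝟙 (Vec.lookup (R B) u) * 𝟙 (Vec.lookup (L B) v)
  covers-𝟙 B disjoint u v
    with Vec.lookup (L B) u in Lu | Vec.lookup (R B) u in Ru | Vec.lookup (L B) v in Lv | Vec.lookup (R B) v in Rv
  ... | true  | true  | _     | _     = contradiction (lookup⇒[]= u (R B) Ru) (disjoint u (lookup⇒[]= u (L B) Lu))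
  ... | _     | _     | true  | true  = contradiction (lookup⇒[]= v (R B) Rv) (disjoint v (lookup⇒[]= v (L B) Lv))
  ... | true  | false | true  | false = refl
  ... | true  | false | false | true  = refl
  ... | true  | false | false | false = refl
  ... | false | true  | true  | false = refl
  ... | false | true  | false | true  = refl
  ... | false | true  | false | false = refl
  ... | false | false | true  | false = refl
  ... | false | false | false | true  = refl
  ... | false | false | false | false = refl

  coverCount-∷ : ∀ {n} (B : Biclique n) Bs u v → + coverCount (B ∷ Bs) u v ≡ 𝟙 (covers B u v) + + coverCount Bs u v
  coverCount-∷ B Bs u v with covers B u v
  ... | true  = refl
  ... | false = refl

  module CliqueCovering {n} (G : Graph n) {m} (p : Fin m → Fin n) (clique : ∀ i j → i ≢ j → Edge G (p i) (p j))
                         (Bs : List (Biclique n)) (partition : IsBicliquePartition G Bs) where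

    side : Biclique n → Fin m → ℤ
    side B i = 𝟙 (Vec.lookup (L B) (p i))

    disjoints : All Disjoint Bs
    disjoints = All.map proj₁ (proj₁ partition)

    module _ (z : Fin m → ℤ) (1·z≡0 : (λ _ → 1ℤ) · z ≡ 0ℤ) (side·z≡0 : All (λ B → side B · z ≡ 0ℤ) Bs) where

      open QuadraticForm z

      Q-biclique : ∀ B → Disjoint B → side B · z ≡ 0ℤ → Q (λ i j → 𝟙 (covers B (p i) (p j))) ≡ 0ℤ
      Q-biclique B disjoint L·z≡0 = begin
        Q (λ i j → 𝟙 (covers B (p i) (p j)))                 ≡⟨ Q-cong (λ i j → covers-𝟙 B disjoint (p i) (p j)) ⟩
        Q (λ i j → side B i * right j + right i * side B j)  ≡⟨ Q-+ (λ i j → side B i * right j) (λ i j → right i * side B j) ⟩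
        Q (λ i j → side B i * right j) + Q (λ i j → right i * side B j)
                                                             ≡⟨ cong₂ _+_ (Q-outer (side B) right) (Q-outer right (side B)) ⟩
        (side B · z) * (right · z) + (right · z) * (side B · z)
                                                             ≡⟨ cong₂ (λ a b → a * (right · z) + (right · z) * b) L·z≡0 L·z≡0 ⟩
        0ℤ * (right · z) + (right · z) * 0ℤ                  ≡⟨ cong₂ _+_ (*-zeroˡ (right · z)) (*-zeroʳ (right · z)) ⟩
        0ℤ                                                   ∎
        where
        right : Fin m → ℤ
        right i = 𝟙 (Vec.lookup (R B) (p i))

      Q-coverCount : ∀ Cs → All Disjoint Cs → All (λ B → side B · z ≡ 0ℤ) Cs →
                       Q (λ i j → + coverCount Cs (p i) (p j)) ≡ 0ℤ
      Q-coverCount []       []       []       = Q-0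
      Q-coverCount (B ∷ Cs) (d ∷ ds) (e ∷ es) = begin
        Q (λ i j → + coverCount (B ∷ Cs) (p i) (p j))
          ≡⟨ Q-cong (λ i j → coverCount-∷ B Cs (p i) (p j)) ⟩
        Q (λ i j → 𝟙 (covers B (p i) (p j)) + + coverCount Cs (p i) (p j))
          ≡⟨ Q-+ (λ i j → 𝟙 (covers B (p i) (p j))) (λ i j → + coverCount Cs (p i) (p j)) ⟩
        Q (λ i j → 𝟙 (covers B (p i) (p j))) + Q (λ i j → + coverCount Cs (p i) (p j))
          ≡⟨ cong₂ _+_ (Q-biclique B d e) (Q-coverCount Cs ds es) ⟩
        0ℤ ∎

      δ+coverCount≡1 : ∀ i j → δ i j + + coverCount Bs (p i) (p j) ≡ 1ℤ
      δ+coverCount≡1 i j with i Fin.≟ j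
      ... | yes refl = cong₂ _+_ (δ-diagonal i) (cong +_ (coverCount-diagonal Bs disjoints (p i)))
      ... | no i≢j   = cong₂ _+_ (δ-off-diagonal i≢j) (cong +_ (proj₂ partition (p i) (p j) (clique i j i≢j)))

      ∑z²≡0 : ∑[ i < m ] (z i * z i) ≡ 0ℤ
      ∑z²≡0 = begin
        ∑[ i < m ] (z i * z i)                               ≡⟨ Q-δ ⟨
        Q δ                                                  ≡⟨ +-identityʳ (Q δ) ⟨
        Q δ + 0ℤ                                             ≡⟨ cong (_+_ (Q δ)) (Q-coverCount Bs disjoints side·z≡0) ⟨
        Q δ + Q (λ i j → + coverCount Bs (p i) (p j))        ≡⟨ Q-+ δ (λ i j → + coverCount Bs (p i) (p j)) ⟨
        Q (λ i j → δ i j + + coverCount Bs (p i) (p j))      ≡⟨ Q-cong δ+coverCount≡1 ⟩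
        Q (λ _ _ → 1ℤ)                                       ≡⟨ Q-outer (λ _ → 1ℤ) (λ _ → 1ℤ) ⟩
        ((λ _ → 1ℤ) · z) * ((λ _ → 1ℤ) · z)                  ≡⟨ cong (λ a → a * a) 1·z≡0 ⟩
        0ℤ                                                   ∎

  graham-pollak : ∀ {n} (G : Graph n) {m} (p : Fin m → Fin n) → (∀ i j → i ≢ j → Edge G (p i) (p j)) →
                  ∀ Bs → IsBicliquePartition G Bs → m ≤ suc (length Bs)
  graham-pollak G {m} p clique Bs partition = ℕ.≮⇒≥ fewer-members-impossible
    where
    open CliqueCovering G p clique Bs partition
    fewer-members-impossible : suc (length Bs) ≮ m
    fewer-members-impossible too-few
      with z , (i , zᵢ≢0) , 1·z≡0 ∷ side·z≡0
             ← nontrivial-solution m ((λ _ → 1ℤ) ∷ map side Bs) (subst (λ k → suc k < m) (sym (length-map side Bs)) too-few)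
      = zᵢ≢0 (∑-squares≡0 z (∑z²≡0 z 1·z≡0 (map⁻ side·z≡0)) i)

open GrahamPollak using (graham-pollak)

module Cliques (H : Graph n) where

  Edge? : ∀ u v → Dec (Edge H u v)
  Edge? u v = Adj H u v Bool.≟ true

  edge-sym : ∀ {x y} → Edge H x y → Edge H y x
  edge-sym {x} {y} = trans (symm H y x)

  edge⇒≢ : ∀ {x y} → Edge H x y → x ≢ y
  edge⇒≢ {x} e refl with () ← trans (sym (irrefl H x)) e

  N : Fin n → Subset n
  N v = setOf (Edge? v)

  ∈-N⁺ : ∀ {v x} → Edge H v x → x ∈ N v
  ∈-N⁺ {v} = ∈-setOf⁺ (Edge? v)

  ∈-N⁻ : ∀ {v x} → x ∈ N v → Edge H v x
  ∈-N⁻ {v} = ∈-setOf⁻ (Edge? v)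

  CompleteTo : Subset n → Fin n → Set
  CompleteTo S v = ∀ u → u ∈ S → u ≢ v → Edge H u v

  NonEdge : Subset n → Set
  NonEdge S = ∃ λ a → ∃ λ b → a ∈ S × b ∈ S × a ≢ b × ¬ Edge H a b

  clique-or-nonEdge : ∀ S → IsClique H S ⊎ NonEdge S
  clique-or-nonEdge S
    with Fin.any? (λ a → Fin.any? (λ b → a ∈? S ×-dec b ∈? S ×-dec ¬? (a Fin.≟ b) ×-dec ¬? (Edge? a b)))
  ... | yes nonEdge = inj₂ nonEdge
  ... | no ¬nonEdge = inj₁ λ a b a∈S b∈S a≢b →
    decidable-stable (Edge? a b) (λ ¬ab → ¬nonEdge (a , b , a∈S , b∈S , a≢b , ¬ab))

  completeTo? : ∀ S v → Dec (CompleteTo S v)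
  completeTo? S v = Fin.all? λ u → u ∈? S →-dec (¬? (u Fin.≟ v) →-dec Edge? u v)

  IsClique-⁅⁆ : ∀ v → IsClique H ⁅ v ⁆
  IsClique-⁅⁆ v a b a∈ b∈ a≢b = contradiction (trans (x∈⁅y⁆⇒x≡y v a∈) (sym (x∈⁅y⁆⇒x≡y v b∈))) a≢b

  IsClique-⊆ : ∀ {S T} → S ⊆ T → IsClique H T → IsClique H S
  IsClique-⊆ S⊆T T-clique a b a∈S b∈S = T-clique a b (S⊆T a∈S) (S⊆T b∈S)

  IsClique-∪⁅⁆ : ∀ {S v} → IsClique H S → CompleteTo S v → IsClique H (S ∪ ⁅ v ⁆)
  IsClique-∪⁅⁆ {S} {v} S-clique v-complete a b a∈ b∈ a≢b with x∈p∪⁅y⁆⁻ S v a∈ | x∈p∪⁅y⁆⁻ S v b∈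
  ... | inj₁ a∈S | inj₁ b∈S = S-clique a b a∈S b∈S a≢b
  ... | inj₁ a∈S | inj₂ refl = v-complete a a∈S a≢b
  ... | inj₂ refl | inj₁ b∈S = edge-sym (v-complete b b∈S (a≢b ∘ sym))
  ... | inj₂ refl | inj₂ refl = contradiction refl a≢b

  IsClique-edge : ∀ {u v} → Edge H u v → IsClique H (⁅ u ⁆ ∪ ⁅ v ⁆)
  IsClique-edge {u} {v} uv = IsClique-∪⁅⁆ (IsClique-⁅⁆ u) λ w w∈ _ → subst (λ w → Edge H w v) (sym (x∈⁅y⁆⇒x≡y u w∈)) uv

  record IsMaximalCliqueIn (W S : Subset n) : Set where
    field
      isClique : IsClique H S
      ⊆W       : S ⊆ W
      maximal  : ∀ {v} → v ∈ W → CompleteTo S v → v ∈ S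
  open IsMaximalCliqueIn public

  absorbs : ∀ {W S T} → IsMaximalCliqueIn W S → IsClique H T → T ⊆ W → S ⊆ T → T ⊆ S
  absorbs S-max T-clique T⊆W S⊆T {t} t∈T =
    maximal S-max (T⊆W t∈T) (λ s s∈S s≢t → T-clique s t (S⊆T s∈S) t∈T s≢t)

  extend : ∀ {W S} → IsClique H S → S ⊆ W → ∃ λ T → IsMaximalCliqueIn W T × S ⊆ T
  extend {W} {S} = go S (⊃-wellFounded S)
    where
    go : ∀ S → Acc _⊃_ S → IsClique H S → S ⊆ W → ∃ λ T → IsMaximalCliqueIn W T × S ⊆ T
    go S (acc larger) S-clique S⊆W
      with Fin.any? (λ v → v ∈? W ×-dec ¬? (v ∈? S) ×-dec completeTo? S v)
    ... | no ¬addable = S , record { isClique = S-clique ; ⊆W = S⊆W ; maximal = maximal′ } , λ s∈S → s∈S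
      where
      maximal′ : ∀ {v} → v ∈ W → CompleteTo S v → v ∈ S
      maximal′ {v} v∈W complete = decidable-stable (v ∈? S) (λ v∉S → ¬addable (v , v∈W , v∉S , complete))
    ... | yes (v , v∈W , v∉S , complete)
      with T , T-max , S∪v⊆T ← go (S ∪ ⁅ v ⁆) (larger (p⊂p∪⁅x⁆ v∉S)) (IsClique-∪⁅⁆ S-clique complete) (p∪⁅x⁆⊆q S⊆W v∈W)
      = T , T-max , S∪v⊆T ∘ x∈p∪q⁺ ∘ inj₁

  maximalIn-⊤⇔ : ∀ {S} → IsMaximalCliqueIn ⊤ S ⇔ IsMaximalClique H S
  maximalIn-⊤⇔ {S} = mk⇔ ⇒maximal maximal⇒
    where
    ⇒maximal : IsMaximalCliqueIn ⊤ S → IsMaximalClique H S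
    ⇒maximal S-max = isClique S-max , λ T T-clique S⊆T → absorbs S-max T-clique ⊆⊤ S⊆T
    maximal⇒ : IsMaximalClique H S → IsMaximalCliqueIn ⊤ S
    maximal⇒ (S-clique , S-max) = record
      { isClique = S-clique
      ; ⊆W       = ⊆⊤
      ; maximal  = λ {v} _ complete →
          S-max (S ∪ ⁅ v ⁆) (IsClique-∪⁅⁆ S-clique complete) (x∈p∪q⁺ ∘ inj₁) (x∈p∪q⁺ (inj₂ (x∈⁅x⁆ v)))
      }

module Paths (H : Graph n) where

  open Cliques H

  private
    variable
      a b c : Fin n
      xs ys : List (Fin n)
      P Q : Pred (Fin n) _

  -- A walk from a is given by the list of the vertices after a.
  Walk : Fin n → List (Fin n) → Set
  Walk a []       = Unit.⊤
  Walk a (b ∷ bs) = Edge H a b × Walk b bs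

  end : Fin n → List (Fin n) → Fin n
  end a []       = a
  end a (b ∷ bs) = end b bs

  walk-++ : ∀ a xs → Walk a xs → Walk (end a xs) ys → Walk a (xs ++ ys)
  walk-++ a []       _         w = w
  walk-++ a (b ∷ bs) (ab , w₁) w = ab , walk-++ b bs w₁ w

  end-++ : ∀ a xs → end a (xs ++ ys) ≡ end (end a xs) ys
  end-++ a []       = refl
  end-++ a (b ∷ bs) = end-++ b bs

  record WalkIn (P : Pred (Fin n) _) (a b : Fin n) : Set where
    constructor walkIn
    field
      steps  : List (Fin n)
      isWalk : Walk a steps
      ends   : end a steps ≡ b
      inside : All P steps

  []ʷ : WalkIn P a a
  []ʷ = walkIn [] tt refl []

  edgeʷ : Edge H a b → P b → WalkIn P a b
  edgeʷ ab Pb = walkIn (_ ∷ []) (ab , tt) refl (Pb ∷ [])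

  infixr 5 _++ʷ_

  _++ʷ_ : WalkIn P a b → WalkIn P b c → WalkIn P a c
  _++ʷ_ {a = a} (walkIn xs w₁ refl in₁) (walkIn ys w₂ refl in₂) =
    walkIn (xs ++ ys) (walk-++ a xs w₁ w₂) (end-++ a xs) (++⁺ in₁ in₂)

  mapʷ : (∀ {x} → P x → Q x) → WalkIn P a b → WalkIn Q a b
  mapʷ P⇒Q (walkIn xs w e in₁) = walkIn xs w e (All.map P⇒Q in₁)

  -- An induced path from a, again given by the vertices after a.
  Induced : Fin n → List (Fin n) → Set
  Induced a []       = Unit.⊤
  Induced a (b ∷ bs) = Edge H a b × All (λ c → a ≢ c × ¬ Edge H a c) bs × Induced b bs

  record InducedPathIn (P : Pred (Fin n) _) (a b : Fin n) : Set where
    constructor pathIn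
    field
      steps     : List (Fin n)
      isInduced : Induced a steps
      ends      : end a steps ≡ b
      inside    : All P steps

  mapᵖ : (∀ {x} → P x → Q x) → InducedPathIn P a b → InducedPathIn Q a b
  mapᵖ P⇒Q (pathIn xs ind e in₁) = pathIn xs ind e (All.map P⇒Q in₁)

  Related : Fin n → Fin n → Set
  Related a c = a ≡ c ⊎ Edge H a c

  private
    attach : Related a c → All (¬_ ∘ Related a) ys → Induced c ys → All P (c ∷ ys) → InducedPathIn P a (end c ys)
    attach (inj₁ refl) _   ind (_ ∷ Pys) = pathIn _ ind refl Pys
    attach (inj₂ ac)  far ind Pcys      =
      pathIn (_ ∷ _) (ac , All.map (λ ¬r → ¬r ∘ inj₁ , ¬r ∘ inj₂) far , ind) refl Pcys

    -- Prepend a to the path c ∷ ys after cutting it at the last vertex related to a.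
    prepend : ∀ a c ys → Induced c ys → Any (Related a) (c ∷ ys) → All P (c ∷ ys) → InducedPathIn P a (end c ys)
    prepend a c ys ind related Pcys with any? (λ w → (a Fin.≟ w) ⊎-dec Edge? a w) ys
    prepend a c (e ∷ ys) (_ , _ , ind) _ (_ ∷ Pys) | yes later = prepend a e ys ind later Pys
    prepend a c ys ind (here r)      Pcys | no ¬later = attach r (¬Any⇒All¬ ys ¬later) ind Pcys
    prepend a c ys ind (there later) Pcys | no ¬later = contradiction later ¬later

  shortcut : WalkIn P a b → InducedPathIn P a b
  shortcut (walkIn [] _ refl _) = pathIn [] tt refl []
  shortcut {a = a} (walkIn (c ∷ xs) (ac , w) refl (Pc ∷ Pxs))
    with pathIn ys ind ends Pys ← shortcut (walkIn xs w refl Pxs)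
    = subst (InducedPathIn _ a) ends (prepend a c ys ind (here (inj₂ ac)) (Pc ∷ Pys))

  two≤length : ∀ {P a b} (path : InducedPathIn P a b) → a ≢ b → ¬ Edge H a b → 2 ≤ length (InducedPathIn.steps path)
  two≤length (pathIn []          _          refl _) a≢b _   = contradiction refl a≢b
  two≤length (pathIn (_ ∷ [])    (ab , _)   refl _) _   ¬ab = contradiction ab ¬ab
  two≤length (pathIn (_ ∷ _ ∷ _) _          _    _) _   _   = s≤s (s≤s z≤n)

  Consecutive : ∀ {k} → Fin k → Fin k → Set
  Consecutive i j = suc (toℕ i) ≡ toℕ j ⊎ suc (toℕ j) ≡ toℕ i

  private
    consecutive-suc : ∀ {k} {i j : Fin k} → Consecutive i j ⇔ Consecutive (suc i) (suc j)
    consecutive-suc = mk⇔ (Sum.map (cong suc) (cong suc)) (Sum.map ℕ.suc-injective ℕ.suc-injective)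

  induced-adjacency : ∀ a ys → Induced a ys → ∀ i j →
                      Edge H (lookup (a ∷ ys) i) (lookup (a ∷ ys) j) ⇔ Consecutive i j
  induced-adjacency a ys _ zero zero =
    mk⇔ (λ aa → contradiction refl (edge⇒≢ aa)) λ { (inj₁ ()) ; (inj₂ ()) }
  induced-adjacency a (b ∷ bs) (ab , _ , _) zero (suc zero) = mk⇔ (λ _ → inj₁ refl) (λ _ → ab)
  induced-adjacency a (b ∷ bs) (ab , _ , _) (suc zero) zero = mk⇔ (λ _ → inj₂ refl) (λ _ → edge-sym ab)
  induced-adjacency a (b ∷ bs) (_ , far , _) zero (suc (suc k)) =
    mk⇔ (λ e → contradiction e (proj₂ (All.lookup far (∈-lookup k)))) λ { (inj₁ ()) ; (inj₂ ()) }
  induced-adjacency a (b ∷ bs) (_ , far , _) (suc (suc k)) zero =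
    mk⇔ (λ e → contradiction (edge-sym e) (proj₂ (All.lookup far (∈-lookup k)))) λ { (inj₁ ()) ; (inj₂ ()) }
  induced-adjacency a (b ∷ bs) (_ , _ , ind) (suc i) (suc j) =
    mk⇔ (to consecutive-suc ∘ to (induced-adjacency b bs ind i j))
        (from (induced-adjacency b bs ind i j) ∘ from consecutive-suc)

  induced-injective : ∀ a ys → Induced a ys → ∀ i j → lookup (a ∷ ys) i ≡ lookup (a ∷ ys) j → i ≡ j
  induced-injective a ys       _             zero          zero          _  = refl
  induced-injective a (b ∷ bs) (ab , _ , _)  zero          (suc zero)    eq = contradiction eq (edge⇒≢ ab)
  induced-injective a (b ∷ bs) (_ , far , _) zero          (suc (suc k)) eq = contradiction eq (proj₁ (All.lookup far (∈-lookup k)))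
  induced-injective a (b ∷ bs) (ab , _ , _)  (suc zero)    zero          eq = contradiction (sym eq) (edge⇒≢ ab)
  induced-injective a (b ∷ bs) (_ , far , _) (suc (suc k)) zero          eq = contradiction (sym eq) (proj₁ (All.lookup far (∈-lookup k)))
  induced-injective a (b ∷ bs) (_ , _ , ind) (suc i)       (suc j)       eq = cong suc (induced-injective b bs ind i j eq)

  lookup-end : ∀ a ys → lookup (a ∷ ys) (fromℕ (length ys)) ≡ end a ys
  lookup-end a []       = refl
  lookup-end a (b ∷ bs) = lookup-end b bs

  induced-cycle : ∀ {u a b} → Edge H u a → Edge H u b →
    (path : InducedPathIn (λ y → y ≡ b ⊎ (u ≢ y × ¬ Edge H u y)) a b) →
    InducedCycle H (suc (suc (length (InducedPathIn.steps path))))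
  induced-cycle {u} {a} ua ub (pathIn ys ind refl Pys) =
    lookup (u ∷ a ∷ ys) , injective , λ i j → mk⇔ (adjacent⇒cycAdj i j) (cycAdj⇒adjacent i j)
    where
    K : ℕ
    K = suc (suc (length ys))

    at-end : ∀ i → lookup (a ∷ ys) i ≡ end a ys → toℕ i ≡ length ys
    at-end i eq = trans (cong toℕ (induced-injective a ys ind i (fromℕ _) (trans eq (sym (lookup-end a ys)))))
                        (Fin.toℕ-fromℕ _)

    end-at : ∀ i → toℕ i ≡ length ys → lookup (a ∷ ys) i ≡ end a ys
    end-at i eq = trans (cong (lookup (a ∷ ys)) (Fin.toℕ-injective (trans eq (sym (Fin.toℕ-fromℕ _)))))
                        (lookup-end a ys)

    u-adjacent⇒end : ∀ i → Edge H u (lookup (a ∷ ys) i) → toℕ i ≡ 0 ⊎ toℕ i ≡ length ys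
    u-adjacent⇒end zero    _ = inj₁ refl
    u-adjacent⇒end (suc i) e with All.lookup Pys (∈-lookup i)
    ... | inj₁ y≡b      = inj₂ (at-end (suc i) y≡b)
    ... | inj₂ (_ , ¬e) = contradiction e ¬e

    end⇒u-adjacent : ∀ i → toℕ i ≡ 0 ⊎ toℕ i ≡ length ys → Edge H u (lookup (a ∷ ys) i)
    end⇒u-adjacent zero    _          = ua
    end⇒u-adjacent (suc i) (inj₂ eq)  = subst (Edge H u) (sym (end-at (suc i) eq)) ub

    u∉path : ∀ i → u ≢ lookup (a ∷ ys) i
    u∉path zero    = edge⇒≢ ua
    u∉path (suc i) with All.lookup Pys (∈-lookup i)
    ... | inj₁ y≡b       = λ u≡y → edge⇒≢ ub (trans u≡y y≡b)
    ... | inj₂ (u≢y , _) = u≢y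

    injective : ∀ i j → lookup (u ∷ a ∷ ys) i ≡ lookup (u ∷ a ∷ ys) j → i ≡ j
    injective zero    zero    _  = refl
    injective zero    (suc j) eq = contradiction eq (u∉path j)
    injective (suc i) zero    eq = contradiction (sym eq) (u∉path i)
    injective (suc i) (suc j) eq = cong suc (induced-injective a ys ind i j eq)

    adjacent⇒cycAdj : ∀ i j → Edge H (lookup (u ∷ a ∷ ys) i) (lookup (u ∷ a ∷ ys) j) → CycAdj K i j
    adjacent⇒cycAdj zero zero e = contradiction refl (edge⇒≢ e)
    adjacent⇒cycAdj zero (suc j) e with u-adjacent⇒end j e
    ... | inj₁ j≡0    = inj₁ (inj₁ (cong suc (sym j≡0)))
    ... | inj₂ j≡last = inj₂ (inj₂ (cong (λ k → suc (suc k)) j≡last , refl))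
    adjacent⇒cycAdj (suc i) zero e with u-adjacent⇒end i (edge-sym e)
    ... | inj₁ i≡0    = inj₂ (inj₁ (cong suc (sym i≡0)))
    ... | inj₂ i≡last = inj₁ (inj₂ (cong (λ k → suc (suc k)) i≡last , refl))
    adjacent⇒cycAdj (suc i) (suc j) e =
      Sum.map (inj₁ ∘ cong suc) (inj₁ ∘ cong suc) (to (induced-adjacency a ys ind i j) e)

    cycAdj⇒adjacent : ∀ i j → CycAdj K i j → Edge H (lookup (u ∷ a ∷ ys) i) (lookup (u ∷ a ∷ ys) j)
    cycAdj⇒adjacent zero    zero    (inj₁ (inj₂ (() , _)))
    cycAdj⇒adjacent zero    zero    (inj₂ (inj₂ (() , _)))
    cycAdj⇒adjacent zero    (suc j) (inj₁ (inj₁ e))       = end⇒u-adjacent j (inj₁ (sym (ℕ.suc-injective e)))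
    cycAdj⇒adjacent zero    (suc j) (inj₂ (inj₂ (e , _))) = end⇒u-adjacent j (inj₂ (ℕ.suc-injective (ℕ.suc-injective e)))
    cycAdj⇒adjacent (suc i) zero    (inj₁ (inj₂ (e , _))) = edge-sym (end⇒u-adjacent i (inj₂ (ℕ.suc-injective (ℕ.suc-injective e))))
    cycAdj⇒adjacent (suc i) zero    (inj₂ (inj₁ e))       = edge-sym (end⇒u-adjacent i (inj₁ (sym (ℕ.suc-injective e))))
    cycAdj⇒adjacent (suc i) (suc j) (inj₁ (inj₁ e))       = from (induced-adjacency a ys ind i j) (inj₁ (ℕ.suc-injective e))
    cycAdj⇒adjacent (suc i) (suc j) (inj₂ (inj₁ e))       = from (induced-adjacency a ys ind i j) (inj₂ (ℕ.suc-injective e))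

  Connected : Subset n → Set
  Connected A = ∀ {a b} → a ∈ A → b ∈ A → WalkIn (_∈ A) a b

  connected-⁅⁆ : ∀ x → Connected ⁅ x ⁆
  connected-⁅⁆ x a∈ b∈ with refl ← x∈⁅y⁆⇒x≡y x a∈ | refl ← x∈⁅y⁆⇒x≡y x b∈ = []ʷ

  connected-∪⁅⁆ : ∀ {R a y} → Connected R → a ∈ R → Edge H a y → Connected (R ∪ ⁅ y ⁆)
  connected-∪⁅⁆ {R} {a} {y} R-connected a∈R ay b∈ c∈ with x∈p∪⁅y⁆⁻ R y b∈ | x∈p∪⁅y⁆⁻ R y c∈
  ... | inj₁ b∈R  | inj₁ c∈R  = mapʷ (x∈p∪q⁺ ∘ inj₁) (R-connected b∈R c∈R)
  ... | inj₁ b∈R  | inj₂ refl = mapʷ (x∈p∪q⁺ ∘ inj₁) (R-connected b∈R a∈R) ++ʷ edgeʷ ay (x∈p∪q⁺ (inj₂ (x∈⁅x⁆ y)))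
  ... | inj₂ refl | inj₁ c∈R  = edgeʷ (edge-sym ay) (x∈p∪q⁺ (inj₁ a∈R)) ++ʷ mapʷ (x∈p∪q⁺ ∘ inj₁) (R-connected a∈R c∈R)
  ... | inj₂ refl | inj₂ refl = []ʷ

  record Component (X : Subset n) (x : Fin n) (A : Subset n) : Set where
    field
      x∈A       : x ∈ A
      A⊆X       : A ⊆ X
      closed    : ∀ {a y} → a ∈ A → y ∈ X → Edge H a y → y ∈ A
      connected : Connected A

  component : ∀ {X x} → x ∈ X → ∃ (Component X x)
  component {X} {x} x∈X = grow ⁅ x ⁆ (⊃-wellFounded _) (x∈⁅x⁆ x) ⁅x⁆⊆X (connected-⁅⁆ x)
    where
    ⁅x⁆⊆X : ⁅ x ⁆ ⊆ X
    ⁅x⁆⊆X y∈ with refl ← x∈⁅y⁆⇒x≡y x y∈ = x∈X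

    grow : ∀ R → Acc _⊃_ R → x ∈ R → R ⊆ X → Connected R → ∃ (Component X x)
    grow R (acc larger) x∈R R⊆X R-connected
      with Fin.any? (λ a → Fin.any? (λ y → a ∈? R ×-dec y ∈? X ×-dec ¬? (y ∈? R) ×-dec Edge? a y))
    ... | no ¬exit = R , record { x∈A = x∈R ; A⊆X = R⊆X ; closed = closed′ ; connected = R-connected }
      where
      closed′ : ∀ {a y} → a ∈ R → y ∈ X → Edge H a y → y ∈ R
      closed′ {a} {y} a∈R y∈X ay = decidable-stable (y ∈? R) (λ y∉R → ¬exit (a , y , a∈R , y∈X , y∉R , ay))
    ... | yes (a , y , a∈R , y∈X , y∉R , ay) =
      grow (R ∪ ⁅ y ⁆) (larger (p⊂p∪⁅x⁆ y∉R)) (x∈p∪q⁺ (inj₁ x∈R)) (p∪⁅x⁆⊆q R⊆X y∈X) (connected-∪⁅⁆ R-connected a∈R ay)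

module SimplicialVertices (H : Graph n) where

  open Cliques H
  open Paths H

  Simplicial : Subset n → Fin n → Set
  Simplicial W t = t ∈ W × IsClique H (W ∩ N t)

  ∈-∩N⁺ : ∀ {W t y} → y ∈ W → Edge H t y → y ∈ W ∩ N t
  ∈-∩N⁺ {t = t} y∈W ty = x∈p∩q⁺ (y∈W , ∈-N⁺ ty)

  ∈-∩N⁻ : ∀ {W t y} → y ∈ W ∩ N t → y ∈ W × Edge H t y
  ∈-∩N⁻ {W} y∈ with y∈W , y∈N ← x∈p∩q⁻ W _ y∈ = y∈W , ∈-N⁻ y∈N

  far? : ∀ W u → Decidable (λ y → y ∈ W × y ≢ u × ¬ Edge H u y)
  far? W u y = y ∈? W ×-dec ¬? (y Fin.≟ u) ×-dec ¬? (Edge? u y)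

  Far : Subset n → Fin n → Subset n
  Far W u = setOf (far? W u)

  ∈-Far⁺ : ∀ {W u y} → y ∈ W → y ≢ u → ¬ Edge H u y → y ∈ Far W u
  ∈-Far⁺ {W} {u} y∈W y≢u ¬uy = ∈-setOf⁺ (far? W u) (y∈W , y≢u , ¬uy)

  ∈-Far⁻ : ∀ {W u y} → y ∈ Far W u → y ∈ W × y ≢ u × ¬ Edge H u y
  ∈-Far⁻ {W} {u} = ∈-setOf⁻ (far? W u)

  -- The neighbours of u next to A; they separate A from u.
  boundary? : ∀ W u A → Decidable (λ s → s ∈ W × Edge H u s × ∃ λ a → a ∈ A × Edge H s a)
  boundary? W u A s = s ∈? W ×-dec Edge? u s ×-dec Fin.any? (λ a → a ∈? A ×-dec Edge? s a)

  Boundary : Subset n → Fin n → Subset n → Subset n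
  Boundary W u A = setOf (boundary? W u A)

  ∈-Boundary⁺ : ∀ {W u A s a} → s ∈ W → Edge H u s → a ∈ A → Edge H s a → s ∈ Boundary W u A
  ∈-Boundary⁺ {W} {u} {A} s∈W us a∈A sa = ∈-setOf⁺ (boundary? W u A) (s∈W , us , _ , a∈A , sa)

  ∈-Boundary⁻ : ∀ {W u A s} → s ∈ Boundary W u A → s ∈ W × Edge H u s × ∃ λ a → a ∈ A × Edge H s a
  ∈-Boundary⁻ {W} {u} {A} = ∈-setOf⁻ (boundary? W u A)

  module Separator {W u x A} (u∈W : u ∈ W) (A-component : Component (Far W u) x A) where

    open Component A-component

    S W′ : Subset n
    S  = Boundary W u A
    W′ = A ∪ S

    A-far : ∀ {a} → a ∈ A → a ∈ W × a ≢ u × ¬ Edge H u a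
    A-far = ∈-Far⁻ ∘ A⊆X

    W′⊂W : W′ ⊂ W
    W′⊂W = W′⊆W , u , u∈W , u∉W′
      where
      W′⊆W : W′ ⊆ W
      W′⊆W y∈ with x∈p∪q⁻ A S y∈
      ... | inj₁ y∈A = proj₁ (A-far y∈A)
      ... | inj₂ y∈S = proj₁ (∈-Boundary⁻ y∈S)
      u∉W′ : u ∉ W′
      u∉W′ u∈ with x∈p∪q⁻ A S u∈
      ... | inj₁ u∈A = proj₁ (proj₂ (A-far u∈A)) refl
      ... | inj₂ u∈S = edge⇒≢ (proj₁ (proj₂ (∈-Boundary⁻ u∈S))) refl

    neighbours-in-W′ : ∀ {a y} → a ∈ A → y ∈ W → Edge H a y → y ∈ W′
    neighbours-in-W′ {a} {y} a∈A y∈W ay with Edge? u y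
    ... | yes uy = x∈p∪q⁺ (inj₂ (∈-Boundary⁺ y∈W uy a∈A (edge-sym ay)))
    ... | no ¬uy = x∈p∪q⁺ (inj₁ (closed a∈A (∈-Far⁺ y∈W y≢u ¬uy) ay))
      where
      y≢u : y ≢ u
      y≢u refl = proj₂ (proj₂ (A-far a∈A)) (edge-sym ay)

    simplicial-lift : ∀ {t} → t ∈ A → Simplicial W′ t → Simplicial W t
    simplicial-lift t∈A (_ , clique) =
      proj₁ (A-far t∈A) ,
      IsClique-⊆ (λ y∈ → let y∈W , ty = ∈-∩N⁻ y∈ in ∈-∩N⁺ (neighbours-in-W′ t∈A y∈W ty) ty) clique

    -- For non-adjacent s₁, s₂ ∈ S, an induced path from s₁ to s₂ through A closes a chordless cycle with u.
    S-clique : Chordal H → IsClique H S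
    S-clique chordal s₁ s₂ s₁∈S s₂∈S s₁≢s₂
      with _ , us₁ , a₁ , a₁∈A , s₁a₁ ← ∈-Boundary⁻ s₁∈S
      with _ , us₂ , a₂ , a₂∈A , s₂a₂ ← ∈-Boundary⁻ s₂∈S
      = decidable-stable (Edge? s₁ s₂) λ ¬s₁s₂ →
      let path = mapᵖ far-or-s₂ (shortcut walk)
      in chordal _ (s≤s (s≤s (two≤length path s₁≢s₂ ¬s₁s₂))) (induced-cycle us₁ us₂ path)
      where
      walk : WalkIn (λ y → y ∈ A ⊎ y ≡ s₂) s₁ s₂
      walk = edgeʷ s₁a₁ (inj₁ a₁∈A) ++ʷ mapʷ inj₁ (connected a₁∈A a₂∈A) ++ʷ edgeʷ (edge-sym s₂a₂) (inj₂ refl)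
      far-or-s₂ : ∀ {y} → y ∈ A ⊎ y ≡ s₂ → y ≡ s₂ ⊎ (u ≢ y × ¬ Edge H u y)
      far-or-s₂ (inj₁ y∈A)  = let _ , y≢u , ¬uy = A-far y∈A in inj₂ (y≢u ∘ sym , ¬uy)
      far-or-s₂ (inj₂ y≡s₂) = inj₁ y≡s₂

  SimplicialAwayFrom : Subset n → Fin n → Set
  SimplicialAwayFrom W u = ∃ λ t → Simplicial W t × t ≢ u × ¬ Edge H u t

  NonNeighbourIn : Subset n → Fin n → Set
  NonNeighbourIn W s = ∃ λ b → b ∈ W × b ≢ s × ¬ Edge H s b

  nonNeighbourIn? : ∀ W s → Dec (NonNeighbourIn W s)
  nonNeighbourIn? W s = Fin.any? (λ b → b ∈? W ×-dec ¬? (b Fin.≟ s) ×-dec ¬? (Edge? s b))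

  -- Dirac: the simplicial vertex is found in the component of x in H[W] − N[u], by recursion on that
  -- component together with its boundary, which is a clique.
  simplicial-away : Chordal H → ∀ W {u x} → u ∈ W → x ∈ W → x ≢ u → ¬ Edge H u x → SimplicialAwayFrom W u
  simplicial-away chordal W = go W (⊂-wellFounded W)
    where
    go : ∀ W → Acc _⊂_ W → ∀ {u x} → u ∈ W → x ∈ W → x ≢ u → ¬ Edge H u x → SimplicialAwayFrom W u
    go W (acc smaller) {u} {x} u∈W x∈W x≢u ¬ux
      with A , A-component ← component (∈-Far⁺ x∈W x≢u ¬ux)
      = away
      where
      open Separator u∈W A-component
      open Component A-component

      from-A : ∀ {t} → t ∈ A → Simplicial W′ t → SimplicialAwayFrom W u
      from-A t∈A t-simplicial =
        _ , simplicial-lift t∈A t-simplicial , proj₁ (proj₂ (A-far t∈A)) , proj₂ (proj₂ (A-far t∈A))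

      recurse : ∀ {u x} → u ∈ W′ → x ∈ W′ → x ≢ u → ¬ Edge H u x → SimplicialAwayFrom W′ u
      recurse = go W′ (smaller W′⊂W)

      -- Recursing away from a vertex of S, or from any vertex if S is complete to W′, gives a vertex in A.
      away : SimplicialAwayFrom W u
      away with clique-or-nonEdge W′
      ... | inj₁ W′-clique = from-A x∈A (x∈p∪q⁺ (inj₁ x∈A) , IsClique-⊆ (p∩q⊆p W′ (N x)) W′-clique)
      ... | inj₂ (a , b , a∈W′ , b∈W′ , a≢b , ¬ab) with Fin.any? (λ s → s ∈? S ×-dec nonNeighbourIn? W′ s)
      ...   | yes (s , s∈S , b′ , b′∈W′ , b′≢s , ¬sb′)
              with t , t-simplicial , t≢s , ¬st ← recurse (x∈p∪q⁺ (inj₂ s∈S)) b′∈W′ b′≢s ¬sb′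
              with x∈p∪q⁻ A S (proj₁ t-simplicial)
      ...     | inj₁ t∈A = from-A t∈A t-simplicial
      ...     | inj₂ t∈S = contradiction (S-clique chordal s t s∈S t∈S (t≢s ∘ sym)) ¬st
      away | inj₂ (a , b , a∈W′ , b∈W′ , a≢b , ¬ab) | no ¬S-nonNeighbour
              with t , t-simplicial , t≢a , ¬at ← recurse a∈W′ b∈W′ (a≢b ∘ sym) ¬ab
              with x∈p∪q⁻ A S (proj₁ t-simplicial)
      ...     | inj₁ t∈A = from-A t∈A t-simplicial
      ...     | inj₂ t∈S = contradiction (edge-sym ta) ¬at
        where
        ta : Edge H t a
        ta = decidable-stable (Edge? t a) λ ¬ta → ¬S-nonNeighbour (t , t∈S , a , a∈W′ , t≢a ∘ sym , ¬ta)

  simplicial-exists : Chordal H → ∀ W {v} → v ∈ W → ∃ (Simplicial W)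
  simplicial-exists chordal W {v} v∈W with clique-or-nonEdge W
  ... | inj₁ W-clique = v , v∈W , IsClique-⊆ (p∩q⊆p W (N v)) W-clique
  ... | inj₂ (a , b , a∈W , b∈W , a≢b , ¬ab) with t , t-simplicial , _ ← simplicial-away chordal W a∈W b∈W (a≢b ∘ sym) ¬ab
    = t , t-simplicial

module LeafCliques (H : Graph n) where

  open Cliques H
  open SimplicialVertices H

  -- C is a leaf of a clique tree: its private vertices P can be removed without C ─ P surviving as a
  -- maximal clique, since C ─ P lies in another maximal clique K.
  record LeafClique (W : Subset n) : Set where
    field
      C K P      : Subset n
      C-maximal  : IsMaximalCliqueIn W C
      K-maximal  : IsMaximalCliqueIn W K
      K⊈C        : ∃ λ y → y ∈ K × y ∉ C
      P-nonempty : Nonempty P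
      P⊆C        : P ⊆ C
      P-private  : ∀ {p z} → p ∈ P → z ∈ W → Edge H p z → z ∈ C
      C─P⊆K      : C ─ P ⊆ K

  -- For v simplicial and Nv = W ∩ N v: if Nv is not maximal in W₁ = W − v, then C₀ = N[v] is a leaf with
  -- P = {v}. Otherwise a leaf C′ of W₁ stays a leaf of W, unless C′ = Nv, when C₀ is one with P = P′ ∪ {v}.
  module AtSimplicial {W v} (v-simplicial : Simplicial W v) where

    v∈W : v ∈ W
    v∈W = proj₁ v-simplicial

    Nv W₁ C₀ : Subset n
    Nv = W ∩ N v
    W₁ = W ─ ⁅ v ⁆
    C₀ = Nv ∪ ⁅ v ⁆

    Nv-clique : IsClique H Nv
    Nv-clique = proj₂ v-simplicial

    W₁⊆W : W₁ ⊆ W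
    W₁⊆W = proj₁ ∘ x∈p-y⁻ W v

    W₁⊂W : W₁ ⊂ W
    W₁⊂W = x∈p⇒p-x⊂p v∈W

    ∈W₁ : ∀ {z} → z ∈ W → z ≢ v → z ∈ W₁
    ∈W₁ = x∈p∧x≢y⇒x∈p-y

    Nv⊆W₁ : Nv ⊆ W₁
    Nv⊆W₁ z∈ = let z∈W , vz = ∈-∩N⁻ z∈ in ∈W₁ z∈W (edge⇒≢ vz ∘ sym)

    Nv⊆C₀ : Nv ⊆ C₀
    Nv⊆C₀ = x∈p∪q⁺ ∘ inj₁

    v∈C₀ : v ∈ C₀
    v∈C₀ = x∈p∪q⁺ (inj₂ (x∈⁅x⁆ v))

    v-private : ∀ {z} → z ∈ W → Edge H v z → z ∈ C₀
    v-private z∈W vz = Nv⊆C₀ (∈-∩N⁺ z∈W vz)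

    ∉C₀ : ∀ {y} → y ∈ W₁ → y ∉ Nv → y ∉ C₀
    ∉C₀ {y} y∈W₁ y∉Nv y∈C₀ with x∈p∪⁅y⁆⁻ Nv v y∈C₀
    ... | inj₁ y∈Nv = y∉Nv y∈Nv
    ... | inj₂ refl = proj₂ (x∈p-y⁻ W v y∈W₁) refl

    C₀-maximal : IsMaximalCliqueIn W C₀
    C₀-maximal = record
      { isClique = IsClique-∪⁅⁆ Nv-clique (λ u u∈Nv _ → edge-sym (proj₂ (∈-∩N⁻ u∈Nv)))
      ; ⊆W       = p∪⁅x⁆⊆q (W₁⊆W ∘ Nv⊆W₁) v∈W
      ; maximal  = maximal′
      }
      where
      maximal′ : ∀ {z} → z ∈ W → CompleteTo C₀ z → z ∈ C₀
      maximal′ {z} z∈W complete with z Fin.≟ v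
      ... | yes refl = v∈C₀
      ... | no z≢v   = v-private z∈W (complete v v∈C₀ (z≢v ∘ sym))

    lift : ∀ {K′} → IsMaximalCliqueIn W₁ K′ → ∃ λ K → IsMaximalCliqueIn W K × K′ ⊆ K
    lift K′-maximal = extend (isClique K′-maximal) (W₁⊆W ∘ ⊆W K′-maximal)

    leaf-at-v : ∀ {y} → y ∈ W₁ → y ∉ Nv → CompleteTo Nv y → LeafClique W
    leaf-at-v {y} y∈W₁ y∉Nv complete
      with K , K-maximal , Nv∪y⊆K ← extend (IsClique-∪⁅⁆ Nv-clique complete) (p∪⁅x⁆⊆q (W₁⊆W ∘ Nv⊆W₁) (W₁⊆W y∈W₁))
      = record
        { C = C₀ ; K = K ; P = ⁅ v ⁆
        ; C-maximal  = C₀-maximal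
        ; K-maximal  = K-maximal
        ; K⊈C        = y , Nv∪y⊆K (x∈p∪q⁺ (inj₂ (x∈⁅x⁆ y))) , ∉C₀ y∈W₁ y∉Nv
        ; P-nonempty = v , x∈⁅x⁆ v
        ; P⊆C        = λ p∈ → x∈p∪q⁺ (inj₂ p∈)
        ; P-private  = λ p∈ → subst (λ p → ∀ {z} → z ∈ W → Edge H p z → z ∈ C₀) (sym (x∈⁅y⁆⇒x≡y v p∈)) v-private
        ; C─P⊆K      = C₀─v⊆K
        }
      where
      C₀─v⊆K : C₀ ─ ⁅ v ⁆ ⊆ K
      C₀─v⊆K z∈ with z∈C₀ , z∉⁅v⁆ ← x∈p─q⁻ C₀ ⁅ v ⁆ z∈ with x∈p∪⁅y⁆⁻ Nv v z∈C₀
      ... | inj₁ z∈Nv = Nv∪y⊆K (x∈p∪q⁺ (inj₁ z∈Nv))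
      ... | inj₂ refl = contradiction (x∈⁅x⁆ v) z∉⁅v⁆

    Nv-maximal-in-W₁ : ¬ (∃ λ y → y ∈ W₁ × y ∉ Nv × CompleteTo Nv y) → IsMaximalCliqueIn W₁ Nv
    Nv-maximal-in-W₁ ¬extensible = record
      { isClique = Nv-clique
      ; ⊆W       = Nv⊆W₁
      ; maximal  = λ {y} y∈W₁ complete → decidable-stable (y ∈? Nv) λ y∉Nv → ¬extensible (y , y∈W₁ , y∉Nv , complete)
      }

    module _ (Nv-maximal₁ : IsMaximalCliqueIn W₁ Nv) where

      v-adjacent : IsClique H W₁ → ∀ {z} → z ∈ W → z ≢ v → Edge H v z
      v-adjacent W₁-clique z∈W z≢v = proj₂ (∈-∩N⁻ (absorbs Nv-maximal₁ W₁-clique (λ z∈ → z∈) Nv⊆W₁ (∈W₁ z∈W z≢v)))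

      clique-lift : IsClique H W₁ → IsClique H W
      clique-lift W₁-clique a b a∈W b∈W a≢b with a Fin.≟ v | b Fin.≟ v
      ... | yes refl | _        = v-adjacent W₁-clique b∈W (a≢b ∘ sym)
      ... | no a≢v   | yes refl = edge-sym (v-adjacent W₁-clique a∈W a≢v)
      ... | no a≢v   | no b≢v   = W₁-clique a b (∈W₁ a∈W a≢v) (∈W₁ b∈W b≢v) a≢b

      module _ (L : LeafClique W₁) where
        open LeafClique L renaming (C to C′; K to K′; P to P′)

        K : Subset n
        K = proj₁ (lift K-maximal)

        K-maximal′ : IsMaximalCliqueIn W K
        K-maximal′ = proj₁ (proj₂ (lift K-maximal))

        K′⊆K : K′ ⊆ K
        K′⊆K = proj₂ (proj₂ (lift K-maximal))

        leaf-extend : C′ ≡ Nv → LeafClique W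
        leaf-extend refl = record
          { C = C₀ ; K = K ; P = P′ ∪ ⁅ v ⁆
          ; C-maximal  = C₀-maximal
          ; K-maximal  = K-maximal′
          ; K⊈C        = let y , y∈K′ , y∉C′ = K⊈C in y , K′⊆K y∈K′ , ∉C₀ (⊆W K-maximal y∈K′) y∉C′
          ; P-nonempty = v , x∈p∪q⁺ (inj₂ (x∈⁅x⁆ v))
          ; P⊆C        = p∪⁅x⁆⊆q (Nv⊆C₀ ∘ P⊆C) v∈C₀
          ; P-private  = private′
          ; C─P⊆K      = C₀─P⊆K
          }
          where
          private′ : ∀ {p z} → p ∈ P′ ∪ ⁅ v ⁆ → z ∈ W → Edge H p z → z ∈ C₀
          private′ {p} {z} p∈ z∈W pz with x∈p∪⁅y⁆⁻ P′ v p∈ | z Fin.≟ v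
          ... | _         | yes refl = v∈C₀
          ... | inj₁ p∈P′ | no z≢v   = Nv⊆C₀ (P-private p∈P′ (∈W₁ z∈W z≢v) pz)
          ... | inj₂ refl | no _     = v-private z∈W pz
          C₀─P⊆K : C₀ ─ (P′ ∪ ⁅ v ⁆) ⊆ K
          C₀─P⊆K z∈ with z∈C₀ , z∉P ← x∈p─q⁻ C₀ _ z∈ with x∈p∪⁅y⁆⁻ Nv v z∈C₀
          ... | inj₁ z∈Nv = K′⊆K (C─P⊆K (x∈p∧x∉q⇒x∈p─q z∈Nv (z∉P ∘ x∈p∪q⁺ ∘ inj₁)))
          ... | inj₂ refl = contradiction (x∈p∪q⁺ (inj₂ (x∈⁅x⁆ v))) z∉P

        leaf-keep : C′ ≢ Nv → LeafClique W
        leaf-keep C′≢Nv = record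
          { C = C′ ; K = K ; P = P′
          ; C-maximal  = C′-maximal
          ; K-maximal  = K-maximal′
          ; K⊈C        = let y , y∈K′ , y∉C′ = K⊈C in y , K′⊆K y∈K′ , y∉C′
          ; P-nonempty = P-nonempty
          ; P⊆C        = P⊆C
          ; P-private  = private′
          ; C─P⊆K      = K′⊆K ∘ C─P⊆K
          }
          where
          ≡Nv : C′ ⊆ Nv → ⊥
          ≡Nv C′⊆Nv = C′≢Nv (⊆-antisym C′⊆Nv (absorbs C-maximal Nv-clique Nv⊆W₁ C′⊆Nv))

          C′-maximal : IsMaximalCliqueIn W C′
          C′-maximal = record { isClique = isClique C-maximal ; ⊆W = W₁⊆W ∘ ⊆W C-maximal ; maximal = maximal′ }
            where
            maximal′ : ∀ {z} → z ∈ W → CompleteTo C′ z → z ∈ C′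
            maximal′ {z} z∈W complete with z Fin.≟ v
            ... | no z≢v   = maximal C-maximal (∈W₁ z∈W z≢v) complete
            ... | yes refl = ⊥-elim (≡Nv λ {c} c∈C′ →
                  let c∈W₁ = ⊆W C-maximal c∈C′ in ∈-∩N⁺ (W₁⊆W c∈W₁) (edge-sym (complete c c∈C′ (proj₂ (x∈p-y⁻ W v c∈W₁)))))

          private′ : ∀ {p z} → p ∈ P′ → z ∈ W → Edge H p z → z ∈ C′
          private′ {p} {z} p∈P′ z∈W pz with z Fin.≟ v
          ... | no z≢v   = P-private p∈P′ (∈W₁ z∈W z≢v) pz
          ... | yes refl = ⊥-elim (≡Nv (absorbs Nv-maximal₁ (isClique C-maximal) (⊆W C-maximal) Nv⊆C′))
            where
            p∈Nv : p ∈ Nv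
            p∈Nv = ∈-∩N⁺ (W₁⊆W (⊆W C-maximal (P⊆C p∈P′))) (edge-sym pz)
            Nv⊆C′ : Nv ⊆ C′
            Nv⊆C′ {w} w∈Nv with w Fin.≟ p
            ... | yes refl = P⊆C p∈P′
            ... | no w≢p   = P-private p∈P′ (Nv⊆W₁ w∈Nv) (Nv-clique p w p∈Nv w∈Nv (w≢p ∘ sym))

    step : IsClique H W₁ ⊎ LeafClique W₁ → IsClique H W ⊎ LeafClique W
    step W₁-result with Fin.any? (λ y → y ∈? W₁ ×-dec ¬? (y ∈? Nv) ×-dec completeTo? Nv y)
    ... | yes (y , y∈W₁ , y∉Nv , complete) = inj₂ (leaf-at-v y∈W₁ y∉Nv complete)
    ... | no ¬extensible with W₁-result
    ...   | inj₁ W₁-clique = inj₁ (clique-lift (Nv-maximal-in-W₁ ¬extensible) W₁-clique)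
    ...   | inj₂ L with ≡-dec Bool._≟_ (LeafClique.C L) Nv
    ...     | yes C′≡Nv = inj₂ (leaf-extend (Nv-maximal-in-W₁ ¬extensible) L C′≡Nv)
    ...     | no C′≢Nv  = inj₂ (leaf-keep (Nv-maximal-in-W₁ ¬extensible) L C′≢Nv)

  leaf-clique : Chordal H → ∀ W → IsClique H W ⊎ LeafClique W
  leaf-clique chordal W = go W (⊂-wellFounded W)
    where
    go : ∀ W → Acc _⊂_ W → IsClique H W ⊎ LeafClique W
    go W (acc smaller) with nonempty? W
    ... | no empty = inj₁ λ a _ a∈W → contradiction (a , a∈W) empty
    ... | yes (_ , v₀∈W) with v , v-simplicial ← simplicial-exists chordal W v₀∈W =
      AtSimplicial.step v-simplicial (go _ (smaller (AtSimplicial.W₁⊂W v-simplicial)))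

module UpperBound (G : Graph n) where

  H : Graph n
  H = complement G

  open Cliques H
  open LeafCliques H

  edge⇒¬coedge : ∀ {u v} → Edge G u v → ¬ Edge H u v
  edge⇒¬coedge {u} {v} uv rewrite uv = λ ()

  ¬coedge⇒edge : ∀ {u v} → u ≢ v → ¬ Edge H u v → Edge G u v
  ¬coedge⇒edge {u} {v} u≢v ¬uv with Adj G u v
  ... | true  = refl
  ... | false with u Fin.≟ v
  ...   | yes u≡v = contradiction u≡v u≢v
  ...   | no _    = contradiction refl ¬uv

  record Decomposition (W : Subset n) : Set where
    field
      cliques   : List (Subset n)
      unique    : Unique cliques
      complete  : ∀ S → S ∈ˡ cliques ⇔ IsMaximalCliqueIn W S
      bicliques : List (Biclique n)
      count     : length cliques ≡ suc (length bicliques)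
      valid     : All (λ B → IsBicliqueOf G B × L B ⊆ W × R B ⊆ W) bicliques
      partition : ∀ {u v} → u ∈ W → v ∈ W → Edge G u v → coverCount bicliques u v ≡ 1

  module Removal {W} (leaf : LeafClique W) where

    open LeafClique leaf

    W′ : Subset n
    W′ = W ─ P

    ∈W′ : ∀ {z} → z ∈ W → z ∉ P → z ∈ W′
    ∈W′ = x∈p∧x∉q⇒x∈p─q

    W′⊆W : W′ ⊆ W
    W′⊆W = proj₁ ∘ x∈p─q⁻ W P

    W′∌P : ∀ {z} → z ∈ W′ → z ∉ P
    W′∌P = proj₂ ∘ x∈p─q⁻ W P

    W′⊂W : W′ ⊂ W
    W′⊂W = let p₀ , p₀∈P = P-nonempty in p∩q≢∅⇒p─q⊂p W P (p₀ , x∈p∩q⁺ (⊆W C-maximal (P⊆C p₀∈P) , p₀∈P))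

    ⊆C : ∀ {M p} → p ∈ P → M ⊆ W → (∀ {m} → m ∈ M → m ≢ p → Edge H p m) → M ⊆ C
    ⊆C {p = p} p∈P M⊆W p-complete {m} m∈M with m Fin.≟ p
    ... | yes refl = P⊆C p∈P
    ... | no m≢p   = P-private p∈P (M⊆W m∈M) (p-complete m∈M m≢p)

    K⊆W′ : K ⊆ W′
    K⊆W′ {z} z∈K = ∈W′ (⊆W K-maximal z∈K) z∉P
      where
      z∉P : z ∉ P
      z∉P z∈P = let _ , y∈K , y∉C = K⊈C in
        y∉C (⊆C z∈P (⊆W K-maximal) (λ m∈K m≢z → isClique K-maximal _ _ z∈K m∈K (m≢z ∘ sym)) y∈K)

    -- This is where K is needed: a vertex of P complete to M gives M ⊆ C ─ P ⊆ K, so M = K ⊈ C.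
    maximal-up : ∀ {M} → IsMaximalCliqueIn W′ M → IsMaximalCliqueIn W M
    maximal-up {M} M-maximal = record
      { isClique = isClique M-maximal ; ⊆W = W′⊆W ∘ ⊆W M-maximal ; maximal = maximal′ }
      where
      maximal′ : ∀ {z} → z ∈ W → CompleteTo M z → z ∈ M
      maximal′ {z} z∈W complete with z ∈? P
      ... | no z∉P  = maximal M-maximal (∈W′ z∈W z∉P) complete
      ... | yes z∈P = let _ , y∈K , y∉C = K⊈C in contradiction (M⊆C (K⊆M y∈K)) y∉C
        where
        M⊆C : M ⊆ C
        M⊆C = ⊆C z∈P (W′⊆W ∘ ⊆W M-maximal) λ m∈M m≢z → edge-sym (complete _ m∈M m≢z)
        K⊆M : K ⊆ M
        K⊆M = absorbs M-maximal (isClique K-maximal) K⊆W′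
                (λ m∈M → C─P⊆K (x∈p∧x∉q⇒x∈p─q (M⊆C m∈M) (W′∌P (⊆W M-maximal m∈M))))

    maximal-down : ∀ {M} → IsMaximalCliqueIn W M → M ≢ C → IsMaximalCliqueIn W′ M
    maximal-down {M} M-maximal M≢C = record
      { isClique = isClique M-maximal ; ⊆W = M⊆W′ ; maximal = maximal M-maximal ∘ W′⊆W }
      where
      M⊆W′ : M ⊆ W′
      M⊆W′ {m} m∈M with m ∈? P
      ... | no m∉P  = ∈W′ (⊆W M-maximal m∈M) m∉P
      ... | yes m∈P = contradiction (⊆-antisym M⊆C (absorbs M-maximal (isClique C-maximal) (⊆W C-maximal) M⊆C)) M≢C
        where
        M⊆C : M ⊆ C
        M⊆C = ⊆C m∈P (⊆W M-maximal) λ m′∈M m′≢m → isClique M-maximal _ _ m∈M m′∈M (m′≢m ∘ sym)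

    -- Joins P to the rest of W′ outside C; these are exactly the G-edges at P.
    B₀ : Biclique n
    B₀ = ⟨ P , W′ ─ C ⟩

    B₀-valid : IsBicliqueOf G B₀ × L B₀ ⊆ W × R B₀ ⊆ W
    B₀-valid = (disjoint , edges) , ⊆W C-maximal ∘ P⊆C , W′⊆W ∘ proj₁ ∘ x∈p─q⁻ W′ C
      where
      disjoint : ∀ v → v ∈ P → v ∉ W′ ─ C
      disjoint v v∈P v∈R = W′∌P (proj₁ (x∈p─q⁻ W′ C v∈R)) v∈P
      edges : ∀ u v → u ∈ P → v ∈ W′ ─ C → Edge G u v
      edges u v u∈P v∈R = ¬coedge⇒edge u≢v λ uv → v∉C (P-private u∈P (W′⊆W v∈W′) uv)
        where
        v∈W′ = proj₁ (x∈p─q⁻ W′ C v∈R)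
        v∉C  = proj₂ (x∈p─q⁻ W′ C v∈R)
        u≢v : u ≢ v
        u≢v refl = W′∌P v∈W′ u∈P

    extend-decomposition : Decomposition W′ → Decomposition W
    extend-decomposition rest = record
      { cliques   = C ∷ cliques′
      ; unique    = All.tabulate (λ M∈ C≡M → C∌ M∈ C≡M) ∷ unique′
      ; complete  = λ S → mk⇔ (to′ S) (from′ S)
      ; bicliques = B₀ ∷ bicliques′
      ; count     = cong suc count′
      ; valid     = B₀-valid ∷ All.map within-W valid′
      ; partition = partition″
      }
      where
      open Decomposition rest renaming
        (cliques to cliques′; unique to unique′; complete to complete′; bicliques to bicliques′;
         count to count′; valid to valid′; partition to partition′)

      within-W : ∀ {B} → IsBicliqueOf G B × L B ⊆ W′ × R B ⊆ W′ → IsBicliqueOf G B × L B ⊆ W × R B ⊆ W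
      within-W (B-valid , L⊆W′ , R⊆W′) = B-valid , W′⊆W ∘ L⊆W′ , W′⊆W ∘ R⊆W′

      C∌ : ∀ {M} → M ∈ˡ cliques′ → C ≢ M
      C∌ M∈ refl = let p₀ , p₀∈P = P-nonempty in W′∌P (⊆W (to (complete′ C) M∈) (P⊆C p₀∈P)) p₀∈P

      to′ : ∀ S → S ∈ˡ C ∷ cliques′ → IsMaximalCliqueIn W S
      to′ S (here refl) = C-maximal
      to′ S (there S∈)  = maximal-up (to (complete′ S) S∈)

      from′ : ∀ S → IsMaximalCliqueIn W S → S ∈ˡ C ∷ cliques′
      from′ S S-maximal with ≡-dec Bool._≟_ S C
      ... | yes refl = here refl
      ... | no S≢C   = there (from (complete′ S) (maximal-down S-maximal S≢C))

      in-C-no-edge : ∀ {u v} → u ∈ C → v ∈ C → ¬ Edge G u v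
      in-C-no-edge u∈C v∈C uv = edge⇒¬coedge uv (isClique C-maximal _ _ u∈C v∈C (Cliques.edge⇒≢ G uv))

      across : ∀ {u v} → u ∈ P → v ∈ W → v ∉ P → Edge G u v → coverCount (B₀ ∷ bicliques′) u v ≡ 1
      across {u} {v} u∈P v∈W v∉P uv
        rewrite covers-∈ {B = B₀} u∈P (x∈p∧x∉q⇒x∈p─q (∈W′ v∈W v∉P) (λ v∈C → in-C-no-edge (P⊆C u∈P) v∈C uv))
        = cong suc (coverCount-outside bicliques′ (All.map proj₂ valid′) v (λ u∈W′ → W′∌P u∈W′ u∈P))

      partition″ : ∀ {u v} → u ∈ W → v ∈ W → Edge G u v → coverCount (B₀ ∷ bicliques′) u v ≡ 1
      partition″ {u} {v} u∈W v∈W uv with u ∈? P | v ∈? P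
      ... | yes u∈P | yes v∈P = contradiction uv (in-C-no-edge (P⊆C u∈P) (P⊆C v∈P))
      ... | yes u∈P | no v∉P  = across u∈P v∈W v∉P uv
      ... | no u∉P  | yes v∈P = trans (coverCount-sym (B₀ ∷ bicliques′) u v) (across v∈P u∈W u∉P (Cliques.edge-sym G uv))
      ... | no u∉P  | no v∉P  rewrite covers-∉L {B = B₀} u∉P v∉P = partition′ (∈W′ u∈W u∉P) (∈W′ v∈W v∉P) uv

  clique-decomposition : ∀ {W} → IsClique H W → Decomposition W
  clique-decomposition {W} W-clique = record
    { cliques   = W ∷ []
    ; unique    = [] ∷ []
    ; complete  = λ S → mk⇔ to′ from′
    ; bicliques = []
    ; count     = refl
    ; valid     = []
    ; partition = λ u∈W v∈W uv → contradiction (W-clique _ _ u∈W v∈W (Cliques.edge⇒≢ G uv)) (edge⇒¬coedge uv)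
    }
    where
    to′ : ∀ {S} → S ∈ˡ W ∷ [] → IsMaximalCliqueIn W S
    to′ (here refl) = record { isClique = W-clique ; ⊆W = λ v∈W → v∈W ; maximal = λ v∈W _ → v∈W }
    from′ : ∀ {S} → IsMaximalCliqueIn W S → S ∈ˡ W ∷ []
    from′ S-maximal = here (⊆-antisym (⊆W S-maximal) (absorbs S-maximal W-clique (λ v∈W → v∈W) (⊆W S-maximal)))

  decomposition : Chordal H → ∀ W → Decomposition W
  decomposition chordal W = go W (⊂-wellFounded W)
    where
    go : ∀ W → Acc _⊂_ W → Decomposition W
    go W (acc smaller) with leaf-clique chordal W
    ... | inj₁ W-clique = clique-decomposition W-clique
    ... | inj₂ leaf     = Removal.extend-decomposition leaf (go _ (smaller (Removal.W′⊂W leaf)))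

lookup-injective : ∀ {A : Set} {xs : List A} → Unique xs → ∀ i j → lookup xs i ≡ lookup xs j → i ≡ j
lookup-injective {xs = _ ∷ _} _                  zero    zero    _  = refl
lookup-injective {xs = _ ∷ _} (x∉xs ∷ _)         zero    (suc j) eq = contradiction eq (All.lookup x∉xs (∈-lookup j))
lookup-injective {xs = _ ∷ _} (x∉xs ∷ _)         (suc i) zero    eq = contradiction (sym eq) (All.lookup x∉xs (∈-lookup i))
lookup-injective {xs = _ ∷ _} (_    ∷ xs-unique) (suc i) (suc j) eq = cong suc (lookup-injective xs-unique i j eq)

module _ (H : Graph n) (irreducible : CliqueVertexIrreducible H) where

  open Cliques H

  private-vertices : ∀ {Ss} → Unique Ss → All (IsMaximalClique H) Ss →
                     ∃ λ (p : Fin (length Ss) → Fin n) → ∀ i j → i ≢ j → p i ≢ p j × ¬ Edge H (p i) (p j)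
  private-vertices {Ss} Ss-unique Ss-maximal = p , λ i j i≢j → distinct i j i≢j , non-adjacent i j i≢j
    where
    Sᵢ-maximal : ∀ i → IsMaximalClique H (lookup Ss i)
    Sᵢ-maximal i = All.lookup Ss-maximal (∈-lookup i)

    p : Fin (length Ss) → Fin n
    p i = proj₁ (irreducible _ (Sᵢ-maximal i))

    p∈Sᵢ : ∀ i → p i ∈ lookup Ss i
    p∈Sᵢ i = proj₁ (proj₂ (irreducible _ (Sᵢ-maximal i)))

    same-clique : ∀ i j T → IsMaximalClique H T → p i ∈ T → p j ∈ T → i ≡ j
    same-clique i j T T-maximal pᵢ∈T pⱼ∈T = lookup-injective Ss-unique i j
      (trans (sym (proj₂ (proj₂ (irreducible _ (Sᵢ-maximal i))) T T-maximal pᵢ∈T))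
                  (proj₂ (proj₂ (irreducible _ (Sᵢ-maximal j))) T T-maximal pⱼ∈T))

    distinct : ∀ i j → i ≢ j → p i ≢ p j
    distinct i j i≢j pᵢ≡pⱼ = i≢j (same-clique i j _ (Sᵢ-maximal i) (p∈Sᵢ i) (subst (_∈ lookup Ss i) pᵢ≡pⱼ (p∈Sᵢ i)))

    non-adjacent : ∀ i j → i ≢ j → ¬ Edge H (p i) (p j)
    non-adjacent i j i≢j pᵢpⱼ with T , T-maximal , pair⊆T ← extend (IsClique-edge pᵢpⱼ) ⊆⊤ =
      i≢j (same-clique i j T (to maximalIn-⊤⇔ T-maximal)
                              (pair⊆T (x∈p∪q⁺ (inj₁ (x∈⁅x⁆ (p i))))) (pair⊆T (x∈p∪q⁺ (inj₂ (x∈⁅x⁆ (p j))))))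

module _ (G : Graph n) (irreducible : CliqueVertexIrreducible (complement G)) where

  open UpperBound G
  open Cliques (complement G) using (maximalIn-⊤⇔)

  bp≡mc∸1 : Decomposition ⊤ → ∃ λ m → HasMC (complement G) m × HasBP G (m ∸ 1)
  bp≡mc∸1 decomposition-of-⊤ =
    length cliques ,
    (cliques , unique , (λ S → maximalIn-⊤⇔ ⇔-∘ complete S) , refl) ,
    ((bicliques , (All.map proj₁ valid , λ _ _ → partition ∈⊤ ∈⊤) , sym (cong (_∸ 1) count)) ,
     λ Bs Bs-partition → ℕ.∸-monoˡ-≤ 1 (graham-pollak G p p-clique Bs Bs-partition))
    where
    open Decomposition decomposition-of-⊤

    independent : ∃ λ (p : Fin (length cliques) → Fin n) →
                    ∀ i j → i ≢ j → p i ≢ p j × ¬ Edge (complement G) (p i) (p j)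
    independent = private-vertices (complement G) irreducible unique
                    (All.tabulate (to maximalIn-⊤⇔ ∘ to (complete _)))

    p : Fin (length cliques) → Fin n
    p = proj₁ independent

    p-clique : ∀ i j → i ≢ j → Edge G (p i) (p j)
    p-clique i j i≢j = let pᵢ≢pⱼ , ¬pᵢpⱼ = proj₂ independent i j i≢j in ¬coedge⇒edge pᵢ≢pⱼ ¬pᵢpⱼ

theorem6 : (n : ℕ) (G : Graph (suc n)) →
           Chordal (complement G) → CliqueVertexIrreducible (complement G) →
           ∃ λ m → HasMC (complement G) m × HasBP G (m ∸ 1)
theorem6 n G chordal irreducible = bp≡mc∸1 G irreducible (UpperBound.decomposition G chordal ⊤)
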